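{- Let $N$, $r$, $m$ be positive integers and $k\geq 1$ an integer. Let $H$ be a simple $(r,m,k)$-daisy with vertex set $V(H)\subseteq[2^N]$, kernel $K_0\cup K_1$ with $|K_0\cup K_1|=k$, universe of petals $M$ with $|M|=m$, and $K_0<M<K_1$. Then there exists a subset $M'\subseteq M$ of size $|M'|=\frac{1}{2}k^{ -1/2}m^{1/2}$ such that the simple $(r,\frac12 k^{ -1/2}m^{1/2},k)$-daisy $H'=H[K_0\cup M'\cup K_1]$ satisfies one of the following: (1) $M'$ is a closed interval in $V(H')$; (2) there exists a maximal comb $I=A\cup B$ in $V(H')$ (handle $A$, teeth $B$) such that $M'\subseteq B$.
   Context: For sets of integers, $X<Y$ means $\max X<\min Y$. A $(k+r)$-uniform hypergraph $H$ is an $(r,m,k)$-daisy if $V(H)=K\cup M$ with $|K|=k$, $|M|=m$ and its edges are exactly $K\cup P$ for $P$ an $r$-subset of $M$; $K$ is the kernel and $M$ the universe of petals. It is simple if $K=K_0\cup K_1$ with $K_0<M<K_1$. $H[S]$ denotes the induced subhypergraph on $S$. Let $T_{[2^N]}$ be the complete binary tree of height $N$ with leaves identified, left to right, with $1,\dots,2^N$; levels are $1$ (root) to $N+1$ (leaves), $\pi(u)$ is the level of $u$. $u$ is an ancestor of $v$ if $\pi(u)<\pi(v)$ and $u$ lies on the root-to-$v$ path. For distinct leaves $x,y$, $a(x,y)$ is their common ancestor of highest level and $\delta(x,y)=\pi(a(x,y))$; put $a(x,x)=x$. For $X=\{x_1<\dots<x_t\}\subseteq[2^N]$ and a vertex $u$,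 $X(u)$ is the set of $x\in X$ with $u$ an ancestor of $x$ or $u=x$. An interval in $X$ is a set of consecutive elements $\{x_p,\dots,x_q\}$; it is closed in $X$ if it equals $X(a(x_p,x_q))$. A closed interval $I$ in $X$ is an $\ell$-left comb if $\ell$ is least such that $I=A\cup B$ with $|A|=\ell$, $B=\{b_1<\dots<b_s\}\ne\emptyset$, $A<B$, $A$ closed in $X$, and $\delta(\max A,b_1)>\delta(b_1,b_2)>\dots>\delta(b_{s-1},b_s)$. It is an $\ell$-right comb if $\ell$ is least such that $I=A\cup B$ with $|A|=\ell$, $B=\{b_1<\dots<b_s\}\ne\emptyset$, $B<A$, $A$ closed in $X$, and $\delta(b_1,b_2)<\dots<\delta(b_{s-1},b_s)<\delta(b_s,\min A)$. $A$ is the handle, $B$ the teeth. A closed interval that is neither is a broken comb, with $A=I$, $B=\emptyset$. $I=\{x_p,\dots,x_q\}$ is a maximal left comb if it is a left comb and $I\cup\{x_{q+1}\}$ is not closed; a maximal right comb if it is a right comb and $I\cup\{x_{p-1}\}$ is not closed; a maximal broken comb if it is a broken comb and neither $I\cup\{x_{p-1}\}$ nor $I\cup\{x_{q+1}\}$ is closed (nonexistent neighbours make the condition automatic). -}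

module Defs where

open import Data.Nat using (ℕ; zero; suc; _+_; _*_; _∸_; _^_; _≤_; _<_; _>_; ⌊_/2⌋)
open import Data.Nat.Properties using (_≟_)
open import Data.List using (List; []; _∷_; _++_; [_]; length)
open import Data.List.Membership.Propositional using (_∈_)
open import Data.List.Relation.Unary.All using (All)
open import Data.Product using (Σ; ∃; ∃-syntax; _×_; _,_)
open import Data.Sum using (_⊎_)
open import Relation.Nullary using (¬_; yes; no)
open import Relation.Binary.PropositionalEquality using (_≡_; _≢_)
open import Function.Bundles using (_⇔_)

-- A vertex is a pair (level, index): level ℓ ∈ {1,…,N+1} (1 = root,
-- N+1 = leaves) and index i < 2^(ℓ-1), counted left to right from 0.
-- Leaf x ∈ {1,…,2^N} is the vertex (N+1, x-1).

record Vtx : Set where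
  constructor vtx
  field
    level : ℕ
    index : ℕ

open Vtx public

shiftR : ℕ → ℕ → ℕ
shiftR zero    x = x
shiftR (suc d) x = shiftR d ⌊ x /2⌋

AncOrSelf : ℕ → Vtx → ℕ → Set
AncOrSelf N u x =
  (1 ≤ level u) × (level u ≤ suc N) × (shiftR (suc N ∸ level u) (x ∸ 1) ≡ index u)

firstEq : ℕ → ℕ → ℕ → ℕ → ℕ
firstEq zero     d x y = d
firstEq (suc f)  d x y with shiftR d x ≟ shiftR d y
... | yes _ = d
... | no  _ = firstEq f (suc d) x y

-- δ(x,y): the highest level of a common ancestor-or-self of leaves x,y
-- (for x ≠ y this is the level of the deepest common ancestor; for
-- x = y it is N+1 = π(x), consistent with a(x,x) = x).
δ : ℕ → ℕ → ℕ → ℕ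
δ N x y = suc N ∸ firstEq N 0 (x ∸ 1) (y ∸ 1)

lca : ℕ → ℕ → ℕ → Vtx
lca N x y = vtx (δ N x y) (shiftR (suc N ∸ δ N x y) (x ∸ 1))

-- Finite sets of leaves are represented by strictly increasing lists.

StrictlySorted : List ℕ → Set
StrictlySorted []       = Data.Unit.⊤
  where import Data.Unit
StrictlySorted (x ∷ xs) = All (x <_) xs × StrictlySorted xs

_≺_ : List ℕ → List ℕ → Set
X ≺ Y = All (λ a → All (a <_) Y) X

_⊆_ : List ℕ → List ℕ → Set
X ⊆ Y = ∀ {x} → x ∈ X → x ∈ Y

-- first / last element (default 0 for the empty list; only ever used on
-- nonempty lists)
hd : List ℕ → ℕ
hd []      = 0
hd (x ∷ _) = x

lst : List ℕ → ℕ
lst []           = 0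
lst (x ∷ [])     = x
lst (_ ∷ y ∷ ys) = lst (y ∷ ys)

Interval : List ℕ → List ℕ → Set
Interval X I = (I ≢ []) × ∃[ pre ] ∃[ suf ] (X ≡ pre ++ I ++ suf)

Closed : ℕ → List ℕ → List ℕ → Set
Closed N X I =
  Interval X I ×
  (∀ x → (x ∈ I) ⇔ ((x ∈ X) × AncOrSelf N (lca N (hd I) (lst I)) x))

DecChain : ℕ → List ℕ → Set
DecChain N []           = Data.Unit.⊤
  where import Data.Unit
DecChain N (x ∷ [])     = Data.Unit.⊤
  where import Data.Unit
DecChain N (x ∷ y ∷ zs) = (δ N x y > δ N y (hd zs) ⊎ zs ≡ []) × DecChain N (y ∷ zs)

IncChain : ℕ → List ℕ → Set
IncChain N []           = Data.Unit.⊤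
  where import Data.Unit
IncChain N (x ∷ [])     = Data.Unit.⊤
  where import Data.Unit
IncChain N (x ∷ y ∷ zs) = (δ N x y < δ N y (hd zs) ⊎ zs ≡ []) × IncChain N (y ∷ zs)

LeftSplit : ℕ → List ℕ → List ℕ → ℕ → List ℕ → List ℕ → Set
LeftSplit N X I ℓ A B =
  (I ≡ A ++ B) × (length A ≡ ℓ) × (B ≢ []) × Closed N X A × DecChain N (lst A ∷ B)

RightSplit : ℕ → List ℕ → List ℕ → ℕ → List ℕ → List ℕ → Set
RightSplit N X I ℓ A B =
  (I ≡ B ++ A) × (length A ≡ ℓ) × (B ≢ []) × Closed N X A × IncChain N (B ++ [ hd A ])

LeftComb : ℕ → List ℕ → List ℕ → List ℕ → List ℕ → Set
LeftComb N X I A B =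
  Closed N X I × LeftSplit N X I (length A) A B ×
  (∀ ℓ' A' B' → ℓ' < length A → ¬ LeftSplit N X I ℓ' A' B')

RightComb : ℕ → List ℕ → List ℕ → List ℕ → List ℕ → Set
RightComb N X I A B =
  Closed N X I × RightSplit N X I (length A) A B ×
  (∀ ℓ' A' B' → ℓ' < length A → ¬ RightSplit N X I ℓ' A' B')

IsLeftComb : ℕ → List ℕ → List ℕ → Set
IsLeftComb N X I = Closed N X I × ∃[ ℓ ] ∃[ A ] ∃[ B ] LeftSplit N X I ℓ A B

IsRightComb : ℕ → List ℕ → List ℕ → Set
IsRightComb N X I = Closed N X I × ∃[ ℓ ] ∃[ A ] ∃[ B ] RightSplit N X I ℓ A B

BrokenComb : ℕ → List ℕ → List ℕ → Set
BrokenComb N X I = Closed N X I × ¬ IsLeftComb N X I × ¬ IsRightComb N X I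

-- I ∪ {x_{q+1}} is not closed (automatic if x_{q+1} does not exist)
NoRightExt : ℕ → List ℕ → List ℕ → Set
NoRightExt N X I = ∀ pre y suf → X ≡ pre ++ I ++ y ∷ suf → ¬ Closed N X (I ++ [ y ])

-- I ∪ {x_{p-1}} is not closed (automatic if x_{p-1} does not exist)
NoLeftExt : ℕ → List ℕ → List ℕ → Set
NoLeftExt N X I = ∀ pre y suf → X ≡ pre ++ y ∷ I ++ suf → ¬ Closed N X (y ∷ I)

MaxComb : ℕ → List ℕ → List ℕ → List ℕ → List ℕ → Set
MaxComb N X I A B =
  (LeftComb N X I A B × NoRightExt N X I) ⊎
  (RightComb N X I A B × NoLeftExt N X I) ⊎
  (BrokenComb N X I × (A ≡ I) × (B ≡ []) × NoLeftExt N X I × NoRightExt N X I)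

Leaves : ℕ → List ℕ → Set
Leaves N X = All (λ x → (1 ≤ x) × (x ≤ 2 ^ N)) X

-- Let dist x y be the height of the lowest common ancestor of the leaves x and y, so that
-- δ = N + 1 − dist; dist is an ultrametric, and a closed interval is a ball of it. Put
-- a = max K₀ and b = min K₁. Every x ∈ M is strictly nearer to b than to K₀, or to a
-- than to K₁; consider the first kind. Along M, dist · b is non-increasing, and the cut
-- values dist b w (w ∈ K₁) split these values into at most |K₁| + 1 classes. Inside one
-- class, points with equal dist · b form a closed interval, while points with strictly
-- decreasing dist · b are the teeth of a right comb whose handle is a ball around b in K₁;
-- that comb extends to a maximal one. Using twice that a sequence of length n with t
-- distinct values has n/t equal terms, one candidate M′ satisfies m ≤ (k + 2)|M′|² ≤ 4k|M′|².

module Submission where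

open import Defs
open import Data.Nat
open import Data.Nat.Properties
open import Data.List using (List; []; _∷_; _++_; [_]; length; reverse; take; drop; takeWhile; dropWhile; filter; map)
open import Data.List.Properties
  using (++-assoc; ++-identityʳ; length-++; length-map; ∷-injective; ∷ʳ-injective; ++-cancelˡ; unfold-reverse;
         reverse-involutive; takeWhile++dropWhile; ≡-dec)
open import Data.List.Membership.Propositional using (_∈_; _∉_)
open import Data.List.Membership.Propositional.Properties using (∈-++⁺ˡ; ∈-++⁺ʳ; ∈-++⁻; ∈-map⁺)
open import Data.List.Membership.DecPropositional _≟_ using (_∈?_)
open import Data.List.Relation.Unary.All as All using (All; []; _∷_)
open import Data.List.Relation.Unary.All.Properties using (++⁺; all-filter; all-takeWhile; all-head-dropWhile)
open import Data.List.Relation.Unary.AllPairs as AllPairs using (AllPairs; []; _∷_)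
open import Data.List.Relation.Unary.Any using (here; there)
open import Data.List.Relation.Binary.Sublist.Propositional
  using ([]; _∷_; _∷ʳ_; minimum; ⊆-refl; ⊆-trans) renaming (_⊆_ to _⊑_)
open import Data.List.Relation.Binary.Sublist.Propositional.Properties
  using (++⁺ˡ; ++⁺ʳ; All-resp-⊆; Any-resp-⊆; filter-⊆)
open import Data.Maybe.Relation.Unary.All using (just)
open import Data.Product using (∃; ∃-syntax; _×_; _,_; proj₁; proj₂)
open import Data.Sum using (_⊎_; inj₁; inj₂; [_,_]′)
open import Data.Empty using (⊥; ⊥-elim)
open import Data.Unit using (tt)
open import Function.Bundles using (mk⇔; Equivalence)
open import Relation.Nullary using (¬_; yes; no; Dec; ¬?)
open import Relation.Nullary.Decidable using (_×-dec_; _→-dec_; _⊎-dec_; map′)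
open import Relation.Unary using (Decidable)
open import Relation.Unary.Properties using (∁?)
open import Relation.Binary using (tri<; tri≈; tri>)
open import Relation.Binary.PropositionalEquality hiding ([_])

-- Binary shifts

shiftR-suc : ∀ d x → shiftR (suc d) x ≡ ⌊ shiftR d x /2⌋
shiftR-suc zero    x = refl
shiftR-suc (suc d) x = shiftR-suc d ⌊ x /2⌋

shiftR-mono-≤ : ∀ d {x y} → x ≤ y → shiftR d x ≤ shiftR d y
shiftR-mono-≤ zero    x≤y = x≤y
shiftR-mono-≤ (suc d) x≤y = shiftR-mono-≤ d (⌊n/2⌋-mono x≤y)

m<n+n⇒⌊m/2⌋<n : ∀ m n → m < n + n → ⌊ m /2⌋ < n
m<n+n⇒⌊m/2⌋<n m             zero    ()
m<n+n⇒⌊m/2⌋<n zero          (suc n) _ = z<s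
m<n+n⇒⌊m/2⌋<n (suc zero)    (suc n) _ = z<s
m<n+n⇒⌊m/2⌋<n (suc (suc m)) (suc n) (s≤s m<n+n) rewrite +-suc n n =
  s≤s (m<n+n⇒⌊m/2⌋<n m n (≤-pred m<n+n))

shiftR-<2^ : ∀ d x → x < 2 ^ d → shiftR d x ≡ 0
shiftR-<2^ zero    zero    _ = refl
shiftR-<2^ zero    (suc x) (s≤s ())
shiftR-<2^ (suc d) x       x<2^d+1 =
  shiftR-<2^ d ⌊ x /2⌋ (m<n+n⇒⌊m/2⌋<n x (2 ^ d) (subst (x <_) (cong (2 ^ d +_) (+-identityʳ (2 ^ d))) x<2^d+1))

u<v<w⇒⌊u/2⌋≢⌊w/2⌋ : ∀ {u v w} → u < v → v < w → ⌊ u /2⌋ ≢ ⌊ w /2⌋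
u<v<w⇒⌊u/2⌋≢⌊w/2⌋ {u} {v} {w} u<v v<w eq =
  <-irrefl eq (⌊n/2⌋-mono {suc (suc u)} {w} (≤-trans (s≤s u<v) v<w))

⌊/2⌋-sameSide : ∀ {u v w} → ⌊ u /2⌋ ≡ ⌊ w /2⌋ → ⌊ v /2⌋ ≡ ⌊ w /2⌋ →
  (u < w × v < w) ⊎ (w < u × w < v) → u ≡ v
⌊/2⌋-sameSide {u} {v} {w} eu ev side with <-cmp u v
... | tri≈ _ u≡v _ = u≡v
⌊/2⌋-sameSide eu ev (inj₁ (_ , v<w)) | tri< u<v _ _ = ⊥-elim (u<v<w⇒⌊u/2⌋≢⌊w/2⌋ u<v v<w eu)
⌊/2⌋-sameSide eu ev (inj₂ (w<u , _)) | tri< u<v _ _ = ⊥-elim (u<v<w⇒⌊u/2⌋≢⌊w/2⌋ w<u u<v (sym ev))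
⌊/2⌋-sameSide eu ev (inj₁ (u<w , _)) | tri> _ _ v<u = ⊥-elim (u<v<w⇒⌊u/2⌋≢⌊w/2⌋ v<u u<w ev)
⌊/2⌋-sameSide eu ev (inj₂ (_ , w<v)) | tri> _ _ v<u = ⊥-elim (u<v<w⇒⌊u/2⌋≢⌊w/2⌋ w<v v<u (sym eu))

ShiftEq : ℕ → ℕ → ℕ → Set
ShiftEq d x y = shiftR d x ≡ shiftR d y

ShiftEq-mono : ∀ {d e x y} → d ≤ e → ShiftEq d x y → ShiftEq e x y
ShiftEq-mono {d} {e} {x} {y} d≤e eq with m≤n⇒m<n∨m≡n d≤e
... | inj₂ refl = eq
ShiftEq-mono {d} {suc e} {x} {y} _ eq | inj₁ (s≤s d≤e) =
  trans (shiftR-suc e x) (trans (cong ⌊_/2⌋ (ShiftEq-mono d≤e eq)) (sym (shiftR-suc e y)))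

firstEq≤ : ∀ f d x y → firstEq f d x y ≤ f + d
firstEq≤ zero    d x y = ≤-refl
firstEq≤ (suc f) d x y with shiftR d x ≟ shiftR d y
... | yes _ = m≤n+m d (suc f)
... | no  _ = subst (firstEq f (suc d) x y ≤_) (+-suc f d) (firstEq≤ f (suc d) x y)

firstEq-minimal : ∀ f d x y e → d ≤ e → e < firstEq f d x y → ¬ ShiftEq e x y
firstEq-minimal zero    d x y e d≤e e<d _ = <-irrefl refl (≤-<-trans d≤e e<d)
firstEq-minimal (suc f) d x y e d≤e e<fe eq with shiftR d x ≟ shiftR d y
... | yes _ = <-irrefl refl (≤-<-trans d≤e e<fe)
... | no d≉ with m≤n⇒m<n∨m≡n d≤e
...   | inj₂ refl = d≉ eq
...   | inj₁ d<e  = firstEq-minimal f (suc d) x y e d<e e<fe eq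

firstEq-found : ∀ f d x y → ShiftEq (firstEq f d x y) x y ⊎ firstEq f d x y ≡ f + d
firstEq-found zero    d x y = inj₂ refl
firstEq-found (suc f) d x y with shiftR d x ≟ shiftR d y
... | yes eq = inj₁ eq
... | no  _ with firstEq-found f (suc d) x y
...   | inj₁ eq = inj₁ eq
...   | inj₂ e  = inj₂ (trans e (+-suc f d))

hd∈ : ∀ {xs} → xs ≢ [] → hd xs ∈ xs
hd∈ {[]}     xs≢[] = ⊥-elim (xs≢[] refl)
hd∈ {x ∷ xs} _     = here refl

lst∈ : ∀ {xs} → xs ≢ [] → lst xs ∈ xs
lst∈ {[]}         xs≢[] = ⊥-elim (xs≢[] refl)
lst∈ {x ∷ []}     _     = here refl
lst∈ {x ∷ y ∷ xs} _     = there (lst∈ {y ∷ xs} λ ())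

hd-++ : ∀ (xs ys : List ℕ) → xs ≢ [] → hd (xs ++ ys) ≡ hd xs
hd-++ []       ys xs≢[] = ⊥-elim (xs≢[] refl)
hd-++ (x ∷ xs) ys _     = refl

lst-++ : ∀ (xs ys : List ℕ) → ys ≢ [] → lst (xs ++ ys) ≡ lst ys
lst-++ []           ys       _     = refl
lst-++ (x ∷ [])     []       ys≢[] = ⊥-elim (ys≢[] refl)
lst-++ (x ∷ [])     (y ∷ ys) _     = refl
lst-++ (x ∷ x′ ∷ xs) ys      ys≢[] = lst-++ (x′ ∷ xs) ys ys≢[]

++-≢[] : ∀ (xs ys : List ℕ) → xs ≢ [] → xs ++ ys ≢ []
++-≢[] []       ys xs≢[] = ⊥-elim (xs≢[] refl)
++-≢[] (x ∷ xs) ys _     ()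

++-[-]-≢[] : ∀ xs (y : ℕ) → xs ++ [ y ] ≢ []
++-[-]-≢[] []       y ()
++-[-]-≢[] (x ∷ xs) y ()

take-length-++ : ∀ (xs ys : List ℕ) → take (length xs) (xs ++ ys) ≡ xs
take-length-++ []       ys = refl
take-length-++ (x ∷ xs) ys = cong (x ∷_) (take-length-++ xs ys)

drop-length-++ : ∀ (xs ys : List ℕ) → drop (length xs) (xs ++ ys) ≡ ys
drop-length-++ []       ys = refl
drop-length-++ (x ∷ xs) ys = drop-length-++ xs ys

length-++-∸ : ∀ (xs ys : List ℕ) → length (xs ++ ys) ∸ length ys ≡ length xs
length-++-∸ xs ys rewrite length-++ xs {ys} = m+n∸n≡m (length xs) (length ys)

length≡0⇒≡[] : ∀ (xs : List ℕ) → length xs ≡ 0 → xs ≡ []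
length≡0⇒≡[] []       _  = refl
length≡0⇒≡[] (x ∷ xs) ()

[]? : (xs : List ℕ) → Dec (xs ≡ [])
[]? []       = yes refl
[]? (x ∷ xs) = no λ ()

≢[]? : (xs : List ℕ) → Dec (xs ≢ [])
≢[]? []       = no λ xs≢[] → xs≢[] refl
≢[]? (x ∷ xs) = yes λ ()

prefix-⊆ : ∀ (B A B′ A′ : List ℕ) → B ++ A ≡ B′ ++ A′ → length A′ ≤ length A → ∀ {x} → x ∈ B → x ∈ B′
prefix-⊆ (b ∷ B) A []        A′ eq A′≤A x∈ rewrite sym eq =
  ⊥-elim (<-irrefl refl (≤-trans (s≤s (subst (length A ≤_) (sym (length-++ B {A})) (m≤n+m (length A) (length B)))) A′≤A))
prefix-⊆ (b ∷ B) A (b′ ∷ B′) A′ eq A′≤A (here refl) with ∷-injective eq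
... | refl , _ = here refl
prefix-⊆ (b ∷ B) A (b′ ∷ B′) A′ eq A′≤A (there x∈) with ∷-injective eq
... | refl , eq′ = there (prefix-⊆ B A B′ A′ eq′ A′≤A x∈)

suffix-⊆ : ∀ (A B A′ B′ : List ℕ) → A ++ B ≡ A′ ++ B′ → length A′ ≤ length A → ∀ {x} → x ∈ B → x ∈ B′
suffix-⊆ A       B []        B′ eq _           x∈ = subst (_ ∈_) eq (∈-++⁺ʳ A x∈)
suffix-⊆ (a ∷ A) B (a′ ∷ A′) B′ eq (s≤s A′≤A) x∈ with ∷-injective eq
... | refl , eq′ = suffix-⊆ A B A′ B′ eq′ A′≤A x∈

StrictlySorted-head : ∀ {x xs z} → StrictlySorted (x ∷ xs) → z ∈ xs → x < z
StrictlySorted-head (x< , _) z∈ = All.lookup x< z∈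

hd-≤ : ∀ {xs z} → StrictlySorted xs → z ∈ xs → hd xs ≤ z
hd-≤ {x ∷ xs} _      (here refl) = ≤-refl
hd-≤ {x ∷ xs} sorted (there z∈)  = <⇒≤ (StrictlySorted-head sorted z∈)

≤-lst : ∀ {xs z} → StrictlySorted xs → z ∈ xs → z ≤ lst xs
≤-lst {x ∷ []}     _            (here refl) = ≤-refl
≤-lst {x ∷ y ∷ xs} sorted       (here refl) = <⇒≤ (StrictlySorted-head sorted (lst∈ {y ∷ xs} λ ()))
≤-lst {x ∷ y ∷ xs} (_ , sorted) (there z∈)  = ≤-lst sorted z∈

StrictlySorted-++ : ∀ {xs ys} → StrictlySorted xs → StrictlySorted ys → xs ≺ ys → StrictlySorted (xs ++ ys)
StrictlySorted-++ {[]}     _            sys _          = sys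
StrictlySorted-++ {x ∷ xs} {ys} (x< , sxs) sys (x≺ ∷ xs≺) = x<xs++ys , StrictlySorted-++ sxs sys xs≺
  where
  x<xs++ys : All (x <_) (xs ++ ys)
  x<xs++ys = All.tabulate λ z∈ → [ All.lookup x< , All.lookup x≺ ]′ (∈-++⁻ xs z∈)

StrictlySorted-++⁻ˡ : ∀ {xs ys} → StrictlySorted (xs ++ ys) → StrictlySorted xs
StrictlySorted-++⁻ˡ {[]}     _             = tt
StrictlySorted-++⁻ˡ {x ∷ xs} (x< , sorted) = All.tabulate (λ z∈ → All.lookup x< (∈-++⁺ˡ z∈)) , StrictlySorted-++⁻ˡ {xs} sorted

StrictlySorted-++⁻ʳ : ∀ {xs ys} → StrictlySorted (xs ++ ys) → StrictlySorted ys
StrictlySorted-++⁻ʳ {[]}     sorted       = sorted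
StrictlySorted-++⁻ʳ {x ∷ xs} (_ , sorted) = StrictlySorted-++⁻ʳ {xs} sorted

StrictlySorted-++⇒< : ∀ {xs ys x y} → StrictlySorted (xs ++ ys) → x ∈ xs → y ∈ ys → x < y
StrictlySorted-++⇒< {x ∷ xs} (x< , _)    (here refl) y∈ = All.lookup x< (∈-++⁺ʳ xs y∈)
StrictlySorted-++⇒< {x ∷ xs} (_ , sorted) (there x∈) y∈ = StrictlySorted-++⇒< {xs} sorted x∈ y∈

StrictlySorted-position : ∀ P P′ {z S S′} → StrictlySorted (P ++ z ∷ S) → P ++ z ∷ S ≡ P′ ++ z ∷ S′ → P ≡ P′
StrictlySorted-position []      []        _        _  = refl
StrictlySorted-position []      (w ∷ P′) {z} (z< , _) eq with ∷-injective eq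
... | refl , eq′ = ⊥-elim (<-irrefl refl (All.lookup z< (subst (z ∈_) (sym eq′) (∈-++⁺ʳ P′ (here refl)))))
StrictlySorted-position (w ∷ P) []       (w< , _) eq with ∷-injective eq
... | refl , _ = ⊥-elim (<-irrefl refl (All.lookup w< (∈-++⁺ʳ P (here refl))))
StrictlySorted-position (w ∷ P) (v ∷ P′) (_ , sorted) eq with ∷-injective eq
... | refl , eq′ = cong (w ∷_) (StrictlySorted-position P P′ sorted eq′)

predecessor-unique : ∀ {X} P J R P′ y S → StrictlySorted X → X ≡ P ++ J ++ R → X ≡ P′ ++ y ∷ J ++ S → J ≢ [] → P ≡ P′ ++ [ y ]
predecessor-unique P []      R P′ y S _      _   _   J≢[] = ⊥-elim (J≢[] refl)
predecessor-unique P (j ∷ J) R P′ y S sorted eq₁ eq₂ _ =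
  StrictlySorted-position P (P′ ++ [ y ]) (subst StrictlySorted eq₁ sorted) (trans (sym eq₁) (trans eq₂ (sym (++-assoc P′ [ y ] (j ∷ J ++ S)))))

successor-unique : ∀ {X} P J R P′ y S → StrictlySorted X → X ≡ P ++ J ++ R → X ≡ P′ ++ J ++ y ∷ S → J ≢ [] → R ≡ y ∷ S
successor-unique P []      R P′ y S _      _   _   J≢[] = ⊥-elim (J≢[] refl)
successor-unique P (j ∷ J) R P′ y S sorted eq₁ eq₂ _
  with StrictlySorted-position P P′ (subst StrictlySorted eq₁ sorted) (trans (sym eq₁) eq₂)
... | refl = ++-cancelˡ (j ∷ J) R (y ∷ S) (++-cancelˡ P _ _ (trans (sym eq₁) eq₂))

reverse-∷-++ : ∀ y Qʳ (J R : List ℕ) → reverse (y ∷ Qʳ) ++ J ++ R ≡ reverse Qʳ ++ (y ∷ J) ++ R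
reverse-∷-++ y Qʳ J R = trans (cong (_++ J ++ R) (unfold-reverse y Qʳ)) (++-assoc (reverse Qʳ) [ y ] (J ++ R))

predecessor∉ : ∀ {X} P y J R → StrictlySorted X → X ≡ P ++ y ∷ J ++ R → y ∉ J
predecessor∉ P y J R sorted X≡ y∈ =
  <-irrefl refl (All.lookup (proj₁ (StrictlySorted-++⁻ʳ {P} (subst StrictlySorted X≡ sorted))) (∈-++⁺ˡ y∈))

successor∉ : ∀ {X} P J y R → StrictlySorted X → X ≡ P ++ J ++ y ∷ R → y ∉ J
successor∉ P J y R sorted X≡ y∈ =
  <-irrefl refl (StrictlySorted-++⇒< {J} (StrictlySorted-++⁻ʳ {P} (subst StrictlySorted X≡ sorted)) y∈ (here refl))

StrictlySorted⇒AllPairs : ∀ {R : ℕ → ℕ → Set} L → StrictlySorted L →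
  (∀ {s t} → s ∈ L → t ∈ L → s < t → R s t) → AllPairs R L
StrictlySorted⇒AllPairs []      _            _ = []
StrictlySorted⇒AllPairs (x ∷ L) (x< , sorted) f =
  All.tabulate (λ t∈ → f (here refl) (there t∈) (All.lookup x< t∈)) ∷ StrictlySorted⇒AllPairs L sorted (λ s∈ t∈ → f (there s∈) (there t∈))

AllPairs-head : ∀ {R : ℕ → ℕ → Set} {xs z} → (∀ {x} → R x x) → AllPairs R xs → z ∈ xs → R (hd xs) z
AllPairs-head {xs = x ∷ xs} refl-R _         (here refl) = refl-R
AllPairs-head {xs = x ∷ xs} _      (x~ ∷ _) (there z∈)  = All.lookup x~ z∈

AllPairs-last : ∀ {R : ℕ → ℕ → Set} {xs z} → (∀ {x} → R x x) → AllPairs R xs → z ∈ xs → R z (lst xs)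
AllPairs-last {xs = x ∷ []}     refl-R _          (here refl) = refl-R
AllPairs-last {xs = x ∷ y ∷ xs} _      (x~ ∷ _)   (here refl) = All.lookup x~ (lst∈ {y ∷ xs} λ ())
AllPairs-last {xs = x ∷ y ∷ xs} refl-R (_ ∷ pairs) (there z∈) = AllPairs-last refl-R pairs z∈

AllPairs-resp-⊑ : ∀ {R : ℕ → ℕ → Set} {xs ys} → xs ⊑ ys → AllPairs R ys → AllPairs R xs
AllPairs-resp-⊑ []           pairs         = pairs
AllPairs-resp-⊑ (_ ∷ʳ xs⊑)   (_ ∷ pairs)   = AllPairs-resp-⊑ xs⊑ pairs
AllPairs-resp-⊑ (refl ∷ xs⊑) (x~ ∷ pairs)  = All-resp-⊆ xs⊑ x~ ∷ AllPairs-resp-⊑ xs⊑ pairs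

StrictlySorted-resp-⊑ : ∀ {xs ys} → xs ⊑ ys → StrictlySorted ys → StrictlySorted xs
StrictlySorted-resp-⊑ []           sorted        = sorted
StrictlySorted-resp-⊑ (_ ∷ʳ xs⊑)   (_ , sorted)  = StrictlySorted-resp-⊑ xs⊑ sorted
StrictlySorted-resp-⊑ (refl ∷ xs⊑) (x< , sorted) = All-resp-⊆ xs⊑ x< , StrictlySorted-resp-⊑ xs⊑ sorted

length-filter-∁ : ∀ {P : ℕ → Set} (P? : Decidable P) xs → length xs ≤ length (filter P? xs) + length (filter (∁? P?) xs)
length-filter-∁ P? []       = z≤n
length-filter-∁ P? (x ∷ xs) with P? x
... | yes _ = s≤s (length-filter-∁ P? xs)
... | no  _ = ≤-trans (s≤s (length-filter-∁ P? xs)) (≤-reflexive (sym (+-suc _ _)))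

minimal-witness : (P : ℕ → Set) → (∀ n → Dec (P n)) → ∀ n → P n → ∃[ j ] j ≤ n × P j × (∀ i → i < j → ¬ P i)
minimal-witness P P? n Pn with search (suc n)
  where
  search : ∀ n → (∃[ j ] j < n × P j × (∀ i → i < j → ¬ P i)) ⊎ (∀ j → j < n → ¬ P j)
  search zero = inj₂ λ j ()
  search (suc n) with search n
  ... | inj₁ (j , j<n , Pj , below) = inj₁ (j , m≤n⇒m≤1+n j<n , Pj , below)
  ... | inj₂ none with P? n
  ...   | yes Pn = inj₁ (n , ≤-refl , Pn , none)
  ...   | no ¬Pn = inj₂ λ j j<1+n → [ none j , (λ { refl → ¬Pn }) ]′ (m≤n⇒m<n∨m≡n (≤-pred j<1+n))
... | inj₁ (j , j<1+n , Pj , below) = j , ≤-pred j<1+n , Pj , below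
... | inj₂ none = ⊥-elim (none n ≤-refl Pn)

dropWhile-stops : ∀ {P : ℕ → Set} (P? : Decidable P) xs → dropWhile P? xs ≡ [] ⊎ ¬ P (hd (dropWhile P? xs))
dropWhile-stops P? xs with dropWhile P? xs | all-head-dropWhile P? xs
... | []    | _         = inj₁ refl
... | _ ∷ _ | just ¬Pr = inj₂ ¬Pr

longest : (P : List ℕ → Set) → ∀ xs ys → P xs → P ys → ∃[ zs ] P zs × length xs ≤ length zs × length ys ≤ length zs
longest P xs ys Pxs Pys with length ys ≤? length xs
... | yes ys≤xs = xs , Pxs , ≤-refl , ys≤xs
... | no  ys≰xs = ys , Pys , <⇒≤ (≰⇒> ys≰xs) , ≤-refl

∈⇒≢[] : ∀ {x : ℕ} {xs} → x ∈ xs → xs ≢ []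
∈⇒≢[] (here _)  ()
∈⇒≢[] (there _) ()

-- Plateaus and descents

descending-length≤ : ∀ (f : ℕ → ℕ) T c → AllPairs (λ s t → f t < f s) T → All (λ t → f t ≤ c) T → length T ≤ suc c
descending-length≤ f []          c       _                _          = z≤n
descending-length≤ f (x ∷ [])    c       _                _          = s≤s z≤n
descending-length≤ f (x ∷ y ∷ T) zero    ((fy<fx ∷ _) ∷ _) (fx≤0 ∷ _) with ≤-trans fy<fx fx≤0
... | ()
descending-length≤ f (x ∷ y ∷ T) (suc c) (x> ∷ pairs)      (fx≤ ∷ _)  =
  s≤s (descending-length≤ f (y ∷ T) c pairs (All.map (λ fy<fx → ≤-pred (≤-trans fy<fx fx≤)) x>))

module _ (g : ℕ → ℕ) where

  record PlateauAndDescent (bound : ℕ) (L : List ℕ) : Set where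
    constructor plateauAndDescent
    field
      E T         : List ℕ
      E⊑L         : E ⊑ L
      T⊑L         : T ⊑ L
      value       : ℕ
      E-constant  : All (λ x → g x ≡ value) E
      T-descends  : AllPairs (λ s t → g t < g s) T
      T-bounded   : All (λ t → g t ≤ bound) T
      length≤     : length L ≤ length T * length E

  -- The run r of value v either grows, or it ends and competes, by length, with the best
  -- plateau found in the rest.
  after-run : ∀ v r L → r ≢ [] → All (λ x → g x ≡ v) r → All (λ y → g y ≤ v) L →
    AllPairs (λ s t → g t ≤ g s) L → PlateauAndDescent v (r ++ L)
  after-run v [] L r≢[] _ _ _ = ⊥-elim (r≢[] refl)
  after-run v (x ∷ r) [] _ (gx≡v ∷ r≡v) _ _ =
    plateauAndDescent (x ∷ r) [ x ] (subst (_⊑_ (x ∷ r)) (sym (++-identityʳ (x ∷ r))) ⊆-refl) (refl ∷ minimum _)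
      v (gx≡v ∷ r≡v) ([] ∷ []) (≤-reflexive gx≡v ∷ []) (≤-reflexive (trans (cong length (++-identityʳ (x ∷ r))) (sym (+-identityʳ _))))
  after-run v r (y ∷ L) r≢[] r≡v (gy≤v ∷ L≤v) (y≥ ∷ pairs) with g y ≟ v
  ... | yes gy≡v = subst (PlateauAndDescent v) (++-assoc r [ y ] L)
        (after-run v (r ++ [ y ]) L (++-≢[] r [ y ] r≢[]) (++⁺ r≡v (gy≡v ∷ [])) (All.map (λ gz≤gy → subst (_ ≤_) gy≡v gz≤gy) y≥) pairs)
  ... | no gy≢v with after-run (g y) [ y ] L (λ ()) (refl ∷ []) y≥ pairs
  ...   | plateauAndDescent E′ T′ E′⊑ T′⊑ c E′≡c T′-desc T′≤gy len′ = extend r r≡v r≢[]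
    where
    gy<v : g y < v
    gy<v = ≤∧≢⇒< gy≤v gy≢v
    T′<v : All (λ t → g t < v) T′
    T′<v = All.map (λ gt≤gy → ≤-<-trans gt≤gy gy<v) T′≤gy
    extend : ∀ r → All (λ x → g x ≡ v) r → r ≢ [] → PlateauAndDescent v (r ++ y ∷ L)
    extend []       _             r≢[] = ⊥-elim (r≢[] refl)
    extend (x ∷ r′) (gx≡v ∷ r′≡v) _ with length E′ ≤? length (x ∷ r′)
    ... | yes E′≤r = plateauAndDescent (x ∷ r′) (x ∷ T′) (++⁺ʳ _ ⊆-refl) (refl ∷ ++⁺ˡ r′ T′⊑) v (gx≡v ∷ r′≡v)
          (All.map (subst (_ <_) (sym gx≡v)) T′<v ∷ T′-desc) (≤-reflexive gx≡v ∷ All.map <⇒≤ T′<v) bound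
      where
      bound : length ((x ∷ r′) ++ y ∷ L) ≤ length (x ∷ T′) * length (x ∷ r′)
      bound = begin
        length ((x ∷ r′) ++ y ∷ L)         ≡⟨ length-++ (x ∷ r′) ⟩
        length (x ∷ r′) + length (y ∷ L)   ≤⟨ +-monoʳ-≤ (length (x ∷ r′)) (≤-trans len′ (*-monoʳ-≤ (length T′) E′≤r)) ⟩
        length (x ∷ r′) + length T′ * length (x ∷ r′) ∎
        where open ≤-Reasoning
    ... | no E′≰r = plateauAndDescent E′ (x ∷ T′) (++⁺ˡ (x ∷ r′) E′⊑) (refl ∷ ++⁺ˡ r′ T′⊑) c E′≡c
          (All.map (subst (_ <_) (sym gx≡v)) T′<v ∷ T′-desc) (≤-reflexive gx≡v ∷ All.map <⇒≤ T′<v) bound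
      where
      bound : length ((x ∷ r′) ++ y ∷ L) ≤ length (x ∷ T′) * length E′
      bound = begin
        length ((x ∷ r′) ++ y ∷ L)         ≡⟨ length-++ (x ∷ r′) ⟩
        length (x ∷ r′) + length (y ∷ L)   ≤⟨ +-mono-≤ (<⇒≤ (≰⇒> E′≰r)) len′ ⟩
        length E′ + length T′ * length E′  ∎
        where open ≤-Reasoning

  plateau-or-descent : ∀ L → AllPairs (λ s t → g t ≤ g s) L → ∃[ v ] PlateauAndDescent v L
  plateau-or-descent []      _            = 0 , plateauAndDescent [] [] [] [] 0 [] [] [] z≤n
  plateau-or-descent (x ∷ L) (x≥ ∷ pairs) = g x , after-run (g x) [ x ] L (λ ()) (refl ∷ []) x≥ pairs

countBelow : ℕ → List ℕ → ℕ
countBelow v []      = 0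
countBelow v (c ∷ C) with c <? v
... | yes _ = suc (countBelow v C)
... | no  _ = countBelow v C

countBelow-mono : ∀ C {v u} → v ≤ u → countBelow v C ≤ countBelow u C
countBelow-mono []      _   = z≤n
countBelow-mono (c ∷ C) {v} {u} v≤u with c <? v | c <? u
... | yes _   | yes _   = s≤s (countBelow-mono C v≤u)
... | yes c<v | no  c≮u = ⊥-elim (c≮u (<-≤-trans c<v v≤u))
... | no  _   | yes _   = m≤n⇒m≤1+n (countBelow-mono C v≤u)
... | no  _   | no  _   = countBelow-mono C v≤u

countBelow-< : ∀ C {v u c} → c ∈ C → v ≤ c → c < u → countBelow v C < countBelow u C
countBelow-< (c ∷ C) {v} {u} (here refl) v≤c c<u with c <? v | c <? u
... | yes c<v | _       = ⊥-elim (<⇒≱ c<v v≤c)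
... | no  _   | no  c≮u = ⊥-elim (c≮u c<u)
... | no  _   | yes _   = s≤s (countBelow-mono C (≤-trans v≤c (<⇒≤ c<u)))
countBelow-< (c′ ∷ C) {v} {u} (there c∈) v≤c c<u with c′ <? v | c′ <? u
... | yes _   | yes _   = s≤s (countBelow-< C c∈ v≤c c<u)
... | yes c′<v | no c′≮u = ⊥-elim (c′≮u (<-trans c′<v (≤-<-trans v≤c c<u)))
... | no  _   | yes _   = m≤n⇒m≤1+n (countBelow-< C c∈ v≤c c<u)
... | no  _   | no  _   = countBelow-< C c∈ v≤c c<u

countBelow≤length : ∀ C v → countBelow v C ≤ length C
countBelow≤length []      v = z≤n
countBelow≤length (c ∷ C) v with c <? v
... | yes _ = s≤s (countBelow≤length C v)
... | no  _ = m≤n⇒m≤1+n (countBelow≤length C v)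

record Refinement (f g : ℕ → ℕ) (c : ℕ) (L : List ℕ) : Set where
  constructor refinement
  field
    E T        : List ℕ
    E⊑L        : E ⊑ L
    T⊑L        : T ⊑ L
    u v        : ℕ
    E-constant : All (λ x → g x ≡ v) E
    T-level    : All (λ x → f x ≡ u) T
    T-descends : AllPairs (λ s t → g t < g s) T
    length≤    : length L ≤ suc c * (length T * length E)

-- First a plateau S of f (at most c + 1 values of f occur), then a plateau or descent of g inside S.
refine : ∀ (f g : ℕ → ℕ) c L → AllPairs (λ s t → f t ≤ f s) L → All (λ x → f x ≤ c) L →
  AllPairs (λ s t → g t ≤ g s) L → Refinement f g c L
refine f g c L f-desc f≤c g-desc with plateau-or-descent f L f-desc
... | _ , plateauAndDescent S T₁ S⊑L T₁⊑L u S≡u T₁-desc _ len₁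
  with plateau-or-descent g S (AllPairs-resp-⊑ S⊑L g-desc)
... | _ , plateauAndDescent E T E⊑S T⊑S v E≡v T-desc _ len₂ =
  refinement E T (⊆-trans E⊑S S⊑L) (⊆-trans T⊑S S⊑L) u v E≡v (All-resp-⊆ T⊑S S≡u) T-desc
    (≤-trans len₁ (*-mono-≤ (descending-length≤ f T₁ c T₁-desc (All-resp-⊆ T₁⊑L f≤c)) len₂))

two-sides-bound : ∀ k₀ k₁ {k s a b c d} → k₀ + k₁ ≡ k → 1 ≤ k → a ≤ s → b ≤ s → c ≤ s → d ≤ s →
  suc k₁ * (a * b) + suc k₀ * (c * d) ≤ 4 * k * (s ^ 2)
two-sides-bound k₀ k₁ {k} {s} {a} {b} {c} {d} k≡ 1≤k a≤s b≤s c≤s d≤s = begin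
  suc k₁ * (a * b) + suc k₀ * (c * d) ≤⟨ +-mono-≤ (*-monoʳ-≤ (suc k₁) (*-mono-≤ a≤s b≤s)) (*-monoʳ-≤ (suc k₀) (*-mono-≤ c≤s d≤s)) ⟩
  suc k₁ * s² + suc k₀ * s²           ≡⟨ *-distribʳ-+ s² (suc k₁) (suc k₀) ⟨
  (suc k₁ + suc k₀) * s²              ≡⟨ cong (_* s²) (trans (+-suc (suc k₁) k₀) (cong (2 +_) (trans (+-comm k₁ k₀) k≡))) ⟩
  (2 + k) * s²                        ≤⟨ *-monoˡ-≤ s² 2+k≤4k ⟩
  4 * k * s²                          ≡⟨ cong (4 * k *_) (cong (s *_) (*-identityʳ s)) ⟨
  4 * k * (s ^ 2)                     ∎
  where
  open ≤-Reasoning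
  s² = s * s
  2+k≤4k : 2 + k ≤ 4 * k
  2+k≤4k = begin
    2 + k     ≤⟨ +-monoˡ-≤ k (*-monoʳ-≤ 2 {1} {k} 1≤k) ⟩
    2 * k + k ≡⟨ +-comm (2 * k) k ⟩
    3 * k     ≤⟨ *-monoˡ-≤ k {3} {4} (s≤s (s≤s (s≤s z≤n))) ⟩
    4 * k     ∎

module _ (N : ℕ) where

  -- The leaf distance

  IsLeaf : ℕ → Set
  IsLeaf x = (1 ≤ x) × (x ≤ 2 ^ N)

  IsLeaf⇒pred< : ∀ {x} → IsLeaf x → x ∸ 1 < 2 ^ N
  IsLeaf⇒pred< {suc x} (_ , x<2^N) = x<2^N

  dist : ℕ → ℕ → ℕ
  dist x y = firstEq N 0 (x ∸ 1) (y ∸ 1)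

  dist≤N : ∀ x y → dist x y ≤ N
  dist≤N x y = ≤-trans (firstEq≤ N 0 (x ∸ 1) (y ∸ 1)) (≤-reflexive (+-identityʳ N))

  record Near (d x y : ℕ) : Set where
    constructor near
    field sameBlock : ShiftEq d (x ∸ 1) (y ∸ 1)

  Near-sym : ∀ {d x y} → Near d x y → Near d y x
  Near-sym (near eq) = near (sym eq)

  Near-trans : ∀ {d x y z} → Near d x y → Near d y z → Near d x z
  Near-trans (near eq) (near eq′) = near (trans eq eq′)

  Near-mono : ∀ {d e x y} → d ≤ e → Near d x y → Near e x y
  Near-mono d≤e (near eq) = near (ShiftEq-mono d≤e eq)

  Near⇒dist≤ : ∀ {d x y} → Near d x y → dist x y ≤ d
  Near⇒dist≤ {d} {x} {y} (near eq) with d <? dist x y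
  ... | yes d<dist = ⊥-elim (firstEq-minimal N 0 (x ∸ 1) (y ∸ 1) d z≤n d<dist eq)
  ... | no  d≮dist = ≮⇒≥ d≮dist

  Near-dist : ∀ {x y} → IsLeaf x → IsLeaf y → Near (dist x y) x y
  Near-dist {x} {y} lx ly with firstEq-found N 0 (x ∸ 1) (y ∸ 1)
  ... | inj₁ eq = near eq
  ... | inj₂ exhausted rewrite exhausted | +-identityʳ N =
    near (trans (shiftR-<2^ N (x ∸ 1) (IsLeaf⇒pred< lx)) (sym (shiftR-<2^ N (y ∸ 1) (IsLeaf⇒pred< ly))))

  dist≤⇒Near : ∀ {d x y} → IsLeaf x → IsLeaf y → dist x y ≤ d → Near d x y
  dist≤⇒Near lx ly dist≤d = Near-mono dist≤d (Near-dist lx ly)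

  dist-sym : ∀ {x y} → IsLeaf x → IsLeaf y → dist x y ≡ dist y x
  dist-sym lx ly = ≤-antisym (Near⇒dist≤ (Near-sym (Near-dist ly lx))) (Near⇒dist≤ (Near-sym (Near-dist lx ly)))

  dist-refl : ∀ x → dist x x ≡ 0
  dist-refl x = n≤0⇒n≡0 (Near⇒dist≤ {0} {x} {x} (near refl))

  dist≡0⇒≡ : ∀ {x y} → IsLeaf x → IsLeaf y → dist x y ≡ 0 → x ≡ y
  dist≡0⇒≡ {suc x} {suc y} lx ly d≡0 =
    cong suc (Near.sameBlock (subst (λ d → Near d (suc x) (suc y)) d≡0 (Near-dist lx ly)))

  dist-pos : ∀ {x y} → IsLeaf x → IsLeaf y → x < y → ∃[ e ] dist x y ≡ suc e
  dist-pos {x} {y} lx ly x<y with dist x y in eq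
  ... | zero  = ⊥-elim (<-irrefl (dist≡0⇒≡ lx ly eq) x<y)
  ... | suc e = e , refl

  dist-ultra : ∀ {x y z} → IsLeaf x → IsLeaf y → IsLeaf z → dist x z ≤ dist x y ⊔ dist y z
  dist-ultra lx ly lz =
    Near⇒dist≤ (Near-trans (dist≤⇒Near lx ly (m≤m⊔n _ _)) (dist≤⇒Near ly lz (m≤n⊔m _ _)))

  Near-betweenˡ : ∀ {d x y z} → x ≤ y → y ≤ z → Near d x z → Near d x y
  Near-betweenˡ {d} x≤y y≤z (near eq) = near (≤-antisym
    (shiftR-mono-≤ d (∸-monoˡ-≤ 1 x≤y))
    (subst (_ ≤_) (sym eq) (shiftR-mono-≤ d (∸-monoˡ-≤ 1 y≤z))))

  Near-betweenʳ : ∀ {d x y z} → x ≤ y → y ≤ z → Near d x z → Near d y z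
  Near-betweenʳ x≤y y≤z near-xz = Near-trans (Near-sym (Near-betweenˡ x≤y y≤z near-xz)) near-xz

  dist-betweenˡ : ∀ {x y z} → IsLeaf x → IsLeaf z → x ≤ y → y ≤ z → dist x y ≤ dist x z
  dist-betweenˡ lx lz x≤y y≤z = Near⇒dist≤ (Near-betweenˡ x≤y y≤z (Near-dist lx lz))

  dist-betweenʳ : ∀ {x y z} → IsLeaf x → IsLeaf z → x ≤ y → y ≤ z → dist y z ≤ dist x z
  dist-betweenʳ lx lz x≤y y≤z = Near⇒dist≤ (Near-betweenʳ x≤y y≤z (Near-dist lx lz))

  dist-isosceles : ∀ {x y z} → IsLeaf x → IsLeaf y → IsLeaf z → dist y z < dist x z → dist x y ≡ dist x z
  dist-isosceles {x} {y} {z} lx ly lz yz<xz = ≤-antisym xy≤xz xz≤xy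
    where
    xy≤xz : dist x y ≤ dist x z
    xy≤xz = ≤-trans (dist-ultra lx lz ly) (⊔-lub ≤-refl (≤-trans (≤-reflexive (dist-sym lz ly)) (<⇒≤ yz<xz)))
    xz≤xy : dist x z ≤ dist x y
    xz≤xy with dist x z ≤? dist x y
    ... | yes le = le
    ... | no  gt = ⊥-elim (<-irrefl refl (≤-<-trans (dist-ultra lx ly lz) (⊔-pres-<m (≰⇒> gt) yz<xz)))

  block : ℕ → ℕ → ℕ
  block e x = shiftR e (x ∸ 1)

  block-mono : ∀ e {x y} → x ≤ y → block e x ≤ block e y
  block-mono e x≤y = shiftR-mono-≤ e (∸-monoˡ-≤ 1 x≤y)

  block-< : ∀ {e x y} → x ≤ y → dist x y ≡ suc e → block e x < block e y
  block-< {e} {x} {y} x≤y d≡ = ≤∧≢⇒< (block-mono e x≤y) λ eq → <-irrefl refl (≤-trans (≤-reflexive (sym d≡)) (Near⇒dist≤ {e} {x} {y} (near eq)))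

  block-parent : ∀ {e x y} → IsLeaf x → IsLeaf y → dist x y ≡ suc e → ⌊ block e x /2⌋ ≡ ⌊ block e y /2⌋
  block-parent {e} {x} {y} lx ly d≡ =
    trans (sym (shiftR-suc e (x ∸ 1))) (trans (Near.sameBlock (Near-mono (≤-reflexive d≡) (Near-dist lx ly))) (shiftR-suc e (y ∸ 1)))

  -- A vertex of the binary tree has only two children, so the leaves x < y < z cannot
  -- pairwise branch off at one and the same vertex.
  dist-consecutive-≢ : ∀ {x y z} → IsLeaf x → IsLeaf y → IsLeaf z → x < y → y < z → dist x y ≢ dist y z
  dist-consecutive-≢ {x} {y} {z} lx ly lz x<y y<z eq with dist-pos lx ly x<y
  ... | e , xy≡ = u<v<w⇒⌊u/2⌋≢⌊w/2⌋ (block-< (<⇒≤ x<y) xy≡) (block-< (<⇒≤ y<z) yz≡)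
                    (trans (block-parent lx ly xy≡) (block-parent ly lz yz≡))
    where
    yz≡ = trans (sym eq) xy≡

  dist-sameSideˡ : ∀ {x y z} → IsLeaf x → IsLeaf y → IsLeaf z → x < z → y < z →
    dist x z ≡ dist y z → dist x y < dist x z
  dist-sameSideˡ {x} {y} {z} lx ly lz x<z y<z eq with dist-pos lx lz x<z
  ... | e , xz≡ = subst (dist x y <_) (sym xz≡) (s≤s (Near⇒dist≤ {e} {x} {y} (near same)))
    where
    yz≡ = trans (sym eq) xz≡
    same : block e x ≡ block e y
    same = ⌊/2⌋-sameSide (block-parent lx lz xz≡) (block-parent ly lz yz≡)
             (inj₁ (block-< (<⇒≤ x<z) xz≡ , block-< (<⇒≤ y<z) yz≡))

  dist-sameSideʳ : ∀ {x y z} → IsLeaf x → IsLeaf y → IsLeaf z → z < x → z < y →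
    dist z x ≡ dist z y → dist x y < dist z x
  dist-sameSideʳ {x} {y} {z} lx ly lz z<x z<y eq with dist-pos lz lx z<x
  ... | e , zx≡ = subst (dist x y <_) (sym zx≡) (s≤s (Near⇒dist≤ {e} {x} {y} (near same)))
    where
    zy≡ = trans (sym eq) zx≡
    same : block e x ≡ block e y
    same = ⌊/2⌋-sameSide (sym (block-parent lz lx zx≡)) (sym (block-parent lz ly zy≡))
             (inj₂ (block-< (<⇒≤ z<x) zx≡ , block-< (<⇒≤ z<y) zy≡))

  AncOrSelf⇒Near : ∀ {x y z} → AncOrSelf N (lca N x y) z → Near (dist x y) z x
  AncOrSelf⇒Near {x} {y} (_ , _ , eq) rewrite m∸[m∸n]≡n (m≤n⇒m≤1+n (dist≤N x y)) = near eq

  Near⇒AncOrSelf : ∀ {x y z} → Near (dist x y) z x → AncOrSelf N (lca N x y) z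
  Near⇒AncOrSelf {x} {y} {z} (near eq) =
    m<n⇒0<n∸m (s≤s (dist≤N x y)) , m∸n≤m (suc N) (dist x y) ,
    subst (λ t → shiftR t (z ∸ 1) ≡ shiftR t (x ∸ 1)) (sym (m∸[m∸n]≡n (m≤n⇒m≤1+n (dist≤N x y)))) eq

  dist<⇒δ> : ∀ {x y z w} → dist z w < dist x y → δ N z w > δ N x y
  dist<⇒δ> {x} {y} zw<xy = ∸-monoʳ-< zw<xy (m≤n⇒m≤1+n (dist≤N x y))

  -- Closed intervals and combs

  AllLeaves : List ℕ → Set
  AllLeaves X = ∀ {z} → z ∈ X → IsLeaf z

  diam : List ℕ → ℕ
  diam I = dist (hd I) (lst I)

  closed-intro : ∀ X P Q I d c → I ≢ [] → X ≡ P ++ I ++ Q → StrictlySorted I → AllLeaves I →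
    Near d (hd I) c → Near d (lst I) c → (∀ {z} → z ∈ X → Near d z c → z ∈ I) → Closed N X I
  closed-intro X P Q I d c I≢[] X≡ sorted leaves hd~c lst~c complete =
    (I≢[] , P , Q , X≡) , λ x → mk⇔ (to x) (from x)
    where
    to : ∀ x → x ∈ I → (x ∈ X) × AncOrSelf N (lca N (hd I) (lst I)) x
    to x x∈ = subst (x ∈_) (sym X≡) (∈-++⁺ʳ P (∈-++⁺ˡ x∈)) ,
      Near⇒AncOrSelf {hd I} {lst I} (Near-sym (Near-betweenˡ (hd-≤ sorted x∈) (≤-lst sorted x∈)
        (Near-dist (leaves (hd∈ I≢[])) (leaves (lst∈ I≢[])))))
    from : ∀ x → (x ∈ X) × AncOrSelf N (lca N (hd I) (lst I)) x → x ∈ I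
    from x (x∈ , anc) =
      complete x∈ (Near-trans (Near-mono (Near⇒dist≤ (Near-trans hd~c (Near-sym lst~c))) (AncOrSelf⇒Near {hd I} {lst I} anc)) hd~c)

  Closed-≢[] : ∀ {X I} → Closed N X I → I ≢ []
  Closed-≢[] ((I≢[] , _) , _) = I≢[]

  Closed-⊆ : ∀ {X I z} → Closed N X I → z ∈ I → z ∈ X
  Closed-⊆ (_ , iff) z∈ = proj₁ (Equivalence.to (iff _) z∈)

  Closed⇒Near : ∀ {X I z} → Closed N X I → z ∈ I → Near (diam I) z (hd I)
  Closed⇒Near {I = I} (_ , iff) z∈ = AncOrSelf⇒Near {hd I} {lst I} (proj₂ (Equivalence.to (iff _) z∈))

  Near⇒∈Closed : ∀ {X I z} → Closed N X I → z ∈ X → Near (diam I) z (hd I) → z ∈ I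
  Near⇒∈Closed {I = I} (_ , iff) z∈ z~ = Equivalence.from (iff _) (z∈ , Near⇒AncOrSelf {hd I} {lst I} z~)

  Closed-dist≤diam : ∀ {X I u v} → Closed N X I → u ∈ I → v ∈ I → dist u v ≤ diam I
  Closed-dist≤diam closed u∈ v∈ = Near⇒dist≤ (Near-trans (Closed⇒Near closed u∈) (Near-sym (Closed⇒Near closed v∈)))

  Closed-diam<dist : ∀ {X I y u} → AllLeaves X → Closed N X I → y ∈ X → y ∉ I → u ∈ I → diam I < dist y u
  Closed-diam<dist {I = I} {y} {u} leaves closed y∈ y∉ u∈ with diam I <? dist y u
  ... | yes diam< = diam<
  ... | no  diam≮ = ⊥-elim (y∉ (Near⇒∈Closed closed y∈
          (Near-trans (dist≤⇒Near (leaves y∈) (leaves (Closed-⊆ closed u∈)) (≮⇒≥ diam≮)) (Closed⇒Near closed u∈))))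

  AncOrSelf? : ∀ u x → Dec (AncOrSelf N u x)
  AncOrSelf? u x = (1 ≤? level u) ×-dec ((level u ≤? suc N) ×-dec (shiftR (suc N ∸ level u) (x ∸ 1) ≟ index u))

  Closed? : ∀ X I → Interval X I → Dec (Closed N X I)
  Closed? X I interval@(_ , P , Q , X≡)
    with All.all? (AncOrSelf? (lca N (hd I) (lst I))) I
       | All.all? (λ x → AncOrSelf? (lca N (hd I) (lst I)) x →-dec (x ∈? I)) X
  ... | yes I-below | yes X-below⇒I =
    yes (interval , λ x → mk⇔ (λ x∈ → subst (x ∈_) (sym X≡) (∈-++⁺ʳ P (∈-++⁺ˡ x∈)) , All.lookup I-below x∈)
                              (λ (x∈ , anc) → All.lookup X-below⇒I x∈ anc))
  ... | no ¬I-below | _ = no λ (_ , iff) → ¬I-below (All.tabulate λ x∈ → proj₂ (Equivalence.to (iff _) x∈))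
  ... | _ | no ¬X-below⇒I = no λ (_ , iff) → ¬X-below⇒I (All.tabulate λ x∈ anc → Equivalence.from (iff _) (x∈ , anc))

  IncChain? : ∀ xs → Dec (IncChain N xs)
  IncChain? []           = yes tt
  IncChain? (x ∷ [])     = yes tt
  IncChain? (x ∷ y ∷ zs) = ((δ N x y <? δ N y (hd zs)) ⊎-dec []? zs) ×-dec IncChain? (y ∷ zs)

  DecChain? : ∀ xs → Dec (DecChain N xs)
  DecChain? []           = yes tt
  DecChain? (x ∷ [])     = yes tt
  DecChain? (x ∷ y ∷ zs) = ((δ N y (hd zs) <? δ N x y) ⊎-dec []? zs) ×-dec DecChain? (y ∷ zs)

  Interval-suffix : ∀ {X I} B A → Interval X I → I ≡ B ++ A → A ≢ [] → Interval X A
  Interval-suffix {X} {I} B A (_ , P , Q , X≡) I≡ A≢[] = A≢[] , P ++ B , Q , (begin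
    X                  ≡⟨ X≡ ⟩
    P ++ I ++ Q        ≡⟨ cong (λ t → P ++ t ++ Q) I≡ ⟩
    P ++ (B ++ A) ++ Q ≡⟨ cong (P ++_) (++-assoc B A Q) ⟩
    P ++ B ++ A ++ Q   ≡⟨ ++-assoc P B (A ++ Q) ⟨
    (P ++ B) ++ A ++ Q ∎)
    where open ≡-Reasoning

  Interval-prefix : ∀ {X I} A B → Interval X I → I ≡ A ++ B → A ≢ [] → Interval X A
  Interval-prefix {X} A B (_ , P , Q , X≡) I≡ A≢[] =
    A≢[] , P , B ++ Q , trans X≡ (trans (cong (λ t → P ++ t ++ Q) I≡) (cong (P ++_) (++-assoc A B Q)))

  RightSplit? : ∀ X I → Interval X I → ∀ ℓ A B → Dec (RightSplit N X I ℓ A B)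
  RightSplit? X I interval ℓ A B with ≡-dec _≟_ I (B ++ A)
  ... | no I≢ = no λ split → I≢ (proj₁ split)
  ... | yes I≡ with ≢[]? A
  ...   | no A≡[] = no λ (_ , _ , _ , closed , _) → A≡[] (Closed-≢[] closed)
  ...   | yes A≢[] = map′ (I≡ ,_) proj₂
          ((length A ≟ ℓ) ×-dec (≢[]? B ×-dec (Closed? X A (Interval-suffix B A interval I≡ A≢[]) ×-dec IncChain? (B ++ [ hd A ]))))

  LeftSplit? : ∀ X I → Interval X I → ∀ ℓ A B → Dec (LeftSplit N X I ℓ A B)
  LeftSplit? X I interval ℓ A B with ≡-dec _≟_ I (A ++ B)
  ... | no I≢ = no λ split → I≢ (proj₁ split)
  ... | yes I≡ with ≢[]? A
  ...   | no A≡[] = no λ (_ , _ , _ , closed , _) → A≡[] (Closed-≢[] closed)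
  ...   | yes A≢[] = map′ (I≡ ,_) proj₂
          ((length A ≟ ℓ) ×-dec (≢[]? B ×-dec (Closed? X A (Interval-prefix A B interval I≡ A≢[]) ×-dec DecChain? (lst A ∷ B))))

  -- A split is determined by the size ℓ of its handle, so the least ℓ can be searched for.
  RightSplitAt : List ℕ → List ℕ → ℕ → Set
  RightSplitAt X I ℓ = RightSplit N X I ℓ (drop (length I ∸ ℓ) I) (take (length I ∸ ℓ) I)

  RightSplit⇒At : ∀ {X I ℓ A B} → RightSplit N X I ℓ A B → RightSplitAt X I ℓ
  RightSplit⇒At {A = A} {B} split@(refl , refl , _)
    rewrite length-++-∸ B A | take-length-++ B A | drop-length-++ B A = split

  LeftSplitAt : List ℕ → List ℕ → ℕ → Set
  LeftSplitAt X I ℓ = LeftSplit N X I ℓ (take ℓ I) (drop ℓ I)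

  LeftSplit⇒At : ∀ {X I ℓ A B} → LeftSplit N X I ℓ A B → LeftSplitAt X I ℓ
  LeftSplit⇒At {A = A} {B} split@(refl , refl , _) rewrite take-length-++ A B | drop-length-++ A B = split

  RightComb-from-split : ∀ {X I ℓ A B} → Closed N X I → RightSplit N X I ℓ A B →
    ∃[ A′ ] ∃[ B′ ] RightComb N X I A′ B′ × (∀ {x} → x ∈ B → x ∈ B′)
  RightComb-from-split {X} {I} {ℓ} {A} {B} closed split@(I≡ , ℓ≡ , _)
    with minimal-witness (RightSplitAt X I) (λ j → RightSplit? X I (proj₁ closed) j _ _) ℓ (RightSplit⇒At split)
  ... | j , j≤ℓ , least@(I≡′ , j≡ , _) , below =
    A′ , B′ , (closed , subst (λ t → RightSplit N X I t A′ B′) (sym j≡) least ,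
               λ ℓ′ _ _ ℓ′<j split′ → below ℓ′ (subst (ℓ′ <_) j≡ ℓ′<j) (RightSplit⇒At split′)) ,
    prefix-⊆ B A B′ A′ (trans (sym I≡) I≡′) (subst (_≤ length A) (sym j≡) (subst (j ≤_) (sym ℓ≡) j≤ℓ))
    where
    A′ = drop (length I ∸ j) I
    B′ = take (length I ∸ j) I

  LeftComb-from-split : ∀ {X I ℓ A B} → Closed N X I → LeftSplit N X I ℓ A B →
    ∃[ A′ ] ∃[ B′ ] LeftComb N X I A′ B′ × (∀ {x} → x ∈ B → x ∈ B′)
  LeftComb-from-split {X} {I} {ℓ} {A} {B} closed split@(I≡ , ℓ≡ , _)
    with minimal-witness (LeftSplitAt X I) (λ j → LeftSplit? X I (proj₁ closed) j _ _) ℓ (LeftSplit⇒At split)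
  ... | j , j≤ℓ , least@(I≡′ , j≡ , _) , below =
    A′ , B′ , (closed , subst (λ t → LeftSplit N X I t A′ B′) (sym j≡) least ,
               λ ℓ′ _ _ ℓ′<j split′ → below ℓ′ (subst (ℓ′ <_) j≡ ℓ′<j) (LeftSplit⇒At split′)) ,
    suffix-⊆ A B A′ B′ (trans (sym I≡) I≡′) (subst (_≤ length A) (sym j≡) (subst (j ≤_) (sym ℓ≡) j≤ℓ))
    where
    A′ = take j I
    B′ = drop j I

  -- Maximal combs

  TeethOfMaxComb : List ℕ → List ℕ → Set
  TeethOfMaxComb X T = ∃[ I ] ∃[ A ] ∃[ B ] MaxComb N X I A B × T ⊆ B

  IncChain-cons : ∀ {X J A} B y → AllLeaves X → Closed N X J → J ≡ B ++ A → A ≢ [] → B ≢ [] → y ∈ X → y ∉ J →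
    IncChain N (B ++ [ hd A ]) → IncChain N (y ∷ B ++ [ hd A ])
  IncChain-cons []        y _      _      _    _    B≢[] _  _  _     = ⊥-elim (B≢[] refl)
  IncChain-cons {A = A} (b ∷ B) y leaves closed refl A≢[] _ y∈ y∉ chain =
    inj₁ (dist<⇒δ> {y} {b} {b} {hd (B ++ [ hd A ])} (≤-<-trans (Closed-dist≤diam closed (here refl) (there (next∈ B)))
                                        (Closed-diam<dist leaves closed y∈ y∉ (here refl)))) , chain
    where
    next∈ : ∀ B → hd (B ++ [ hd A ]) ∈ B ++ A
    next∈ []      = hd∈ A≢[]
    next∈ (_ ∷ _) = here refl

  DecChain-snoc : ∀ x xs y → (∀ {u v} → u ∈ x ∷ xs → v ∈ x ∷ xs → dist u v < dist (lst (x ∷ xs)) y) →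
    DecChain N (x ∷ xs) → DecChain N (x ∷ xs ++ [ y ])
  DecChain-snoc x []            y _     _               = inj₂ refl , tt
  DecChain-snoc x (x₂ ∷ [])     y small _               = inj₁ (dist<⇒δ> {x₂} {y} {x} {x₂} (small (here refl) (there (here refl)))) , inj₂ refl , tt
  DecChain-snoc x (x₂ ∷ x₃ ∷ xs) y small (inj₁ δ> , chain) =
    inj₁ δ> , DecChain-snoc x₂ (x₃ ∷ xs) y (λ u∈ v∈ → small (there u∈) (there v∈)) chain

  -- Grow J leftwards while it stays closed; each new element is a new tooth.
  RightSplit⇒maxComb : ∀ {X} → StrictlySorted X → AllLeaves X → ∀ Qʳ J R {ℓ A B} →
    X ≡ reverse Qʳ ++ J ++ R → Closed N X J → RightSplit N X J ℓ A B → TeethOfMaxComb X B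
  RightSplit⇒maxComb sorted leaves [] J R X≡ closed split with RightComb-from-split closed split
  ... | A′ , B′ , comb , B⊆B′ = J , A′ , B′ , inj₂ (inj₁ (comb , no-left-ext)) , B⊆B′
    where
    no-left-ext : NoLeftExt N _ J
    no-left-ext P y S X≡′ _ = ++-[-]-≢[] P y (sym (predecessor-unique [] J R P y S sorted X≡ X≡′ (Closed-≢[] closed)))
  RightSplit⇒maxComb {X} sorted leaves (y ∷ Qʳ) J R {ℓ} {A} {B} X≡ closed split@(J≡ , ℓ≡ , B≢[] , closedA , chain)
    with Closed? X (y ∷ J) ((λ ()) , reverse Qʳ , R , X≡′)
    where
    X≡′ = trans X≡ (reverse-∷-++ y Qʳ J R)
  ... | yes closed′ with RightSplit⇒maxComb sorted leaves Qʳ (y ∷ J) R X≡′ closed′ split′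
    where
    X≡′ = trans X≡ (reverse-∷-++ y Qʳ J R)
    y∈ : y ∈ X
    y∈ = subst (y ∈_) (sym X≡′) (∈-++⁺ʳ (reverse Qʳ) (here refl))
    split′ : RightSplit N X (y ∷ J) ℓ A (y ∷ B)
    split′ = cong (y ∷_) J≡ , ℓ≡ , (λ ()) , closedA ,
      IncChain-cons B y leaves closed J≡ (Closed-≢[] closedA) B≢[] y∈ (predecessor∉ (reverse Qʳ) y J R sorted X≡′) chain
  ...   | I , A′ , B′ , maxComb , y∷B⊆B′ = I , A′ , B′ , maxComb , λ x∈ → y∷B⊆B′ (there x∈)
  RightSplit⇒maxComb sorted leaves (y ∷ Qʳ) J R X≡ closed split | no ¬closed′ with RightComb-from-split closed split
  ... | A′ , B′ , comb , B⊆B′ = J , A′ , B′ , inj₂ (inj₁ (comb , no-left-ext)) , B⊆B′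
    where
    no-left-ext : NoLeftExt N _ J
    no-left-ext P y′ S X≡′ closed′
      with ∷ʳ-injective (reverse Qʳ) P (trans (sym (unfold-reverse y Qʳ))
             (predecessor-unique (reverse (y ∷ Qʳ)) J R P y′ S sorted X≡ X≡′ (Closed-≢[] closed)))
    ... | _ , refl = ¬closed′ closed′

  -- Grow J rightwards while it stays closed; each new element is a new tooth.
  LeftSplit⇒maxComb : ∀ {X} → StrictlySorted X → AllLeaves X → ∀ P J R {ℓ A B} →
    X ≡ P ++ J ++ R → Closed N X J → LeftSplit N X J ℓ A B → TeethOfMaxComb X B
  LeftSplit⇒maxComb sorted leaves P J [] X≡ closed split with LeftComb-from-split closed split
  ... | A′ , B′ , comb , B⊆B′ = J , A′ , B′ , inj₁ (comb , no-right-ext) , B⊆B′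
    where
    no-right-ext : NoRightExt N _ J
    no-right-ext P′ y S X≡′ _ with successor-unique P J [] P′ y S sorted X≡ X≡′ (Closed-≢[] closed)
    ... | ()
  LeftSplit⇒maxComb {X} sorted leaves P J (y ∷ R) {ℓ} {A} {B} X≡ closed split@(J≡ , ℓ≡ , _ , closedA , chain)
    with Closed? X (J ++ [ y ]) (++-[-]-≢[] J y , P , R , X≡′)
    where
    X≡′ = trans X≡ (cong (P ++_) (sym (++-assoc J [ y ] R)))
  ... | yes closed′ with LeftSplit⇒maxComb sorted leaves P (J ++ [ y ]) R X≡′ closed′ split′
    where
    X≡′ = trans X≡ (cong (P ++_) (sym (++-assoc J [ y ] R)))
    A≢[] = Closed-≢[] closedA
    y∈ : y ∈ X
    y∈ = subst (y ∈_) (sym X≡) (∈-++⁺ʳ P (∈-++⁺ʳ J (here refl)))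
    ∈J : ∀ {z} → z ∈ lst A ∷ B → z ∈ J
    ∈J (here refl) = subst (_ ∈_) (sym J≡) (∈-++⁺ˡ (lst∈ A≢[]))
    ∈J (there z∈)  = subst (_ ∈_) (sym J≡) (∈-++⁺ʳ A z∈)
    last∈J = ∈J (lst∈ {lst A ∷ B} λ ())
    small : ∀ {u v} → u ∈ lst A ∷ B → v ∈ lst A ∷ B → dist u v < dist (lst (lst A ∷ B)) y
    small u∈ v∈ = ≤-<-trans (Closed-dist≤diam closed (∈J u∈) (∈J v∈))
      (subst (diam J <_) (dist-sym (leaves y∈) (leaves (Closed-⊆ closed last∈J)))
        (Closed-diam<dist leaves closed y∈ (successor∉ P J y R sorted X≡) last∈J))
    split′ : LeftSplit N X (J ++ [ y ]) ℓ A (B ++ [ y ])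
    split′ = trans (cong (_++ [ y ]) J≡) (++-assoc A B [ y ]) , ℓ≡ , ++-[-]-≢[] B y , closedA ,
      DecChain-snoc (lst A) B y small chain
  ...   | I , A′ , B′ , maxComb , B++y⊆B′ = I , A′ , B′ , maxComb , λ x∈ → B++y⊆B′ (∈-++⁺ˡ x∈)
  LeftSplit⇒maxComb sorted leaves P J (y ∷ R) X≡ closed split | no ¬closed′ with LeftComb-from-split closed split
  ... | A′ , B′ , comb , B⊆B′ = J , A′ , B′ , inj₁ (comb , no-right-ext) , B⊆B′
    where
    no-right-ext : NoRightExt N _ J
    no-right-ext P′ y′ S X≡′ closed′ with successor-unique P J (y ∷ R) P′ y′ S sorted X≡ X≡′ (Closed-≢[] closed)
    ... | refl = ¬closed′ closed′

  -- Closed plateaus and combs from descents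

  module Equidistant (K₀ E K₁ : List ℕ) (sorted : StrictlySorted (K₀ ++ E ++ K₁))
                     (leaves : AllLeaves (K₀ ++ E ++ K₁)) (E≢[] : E ≢ []) where

    private
      X = K₀ ++ E ++ K₁
      e₁ = hd E
      e₁∈ = hd∈ E≢[]
      eₗ∈ = lst∈ E≢[]
      leaf-e₁ = leaves (∈-++⁺ʳ K₀ (∈-++⁺ˡ e₁∈))
      leaf-eₗ = leaves (∈-++⁺ʳ K₀ (∈-++⁺ˡ eₗ∈))

    closed-if-far : (∀ {z} → z ∈ K₀ → Near (diam E) z e₁ → ⊥) → (∀ {z} → z ∈ K₁ → Near (diam E) z e₁ → ⊥) → Closed N X E
    closed-if-far K₀-far K₁-far =
      closed-intro X K₀ K₁ E (diam E) e₁ E≢[] refl (StrictlySorted-++⁻ˡ {E} (StrictlySorted-++⁻ʳ {K₀} sorted))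
        (λ z∈ → leaves (∈-++⁺ʳ K₀ (∈-++⁺ˡ z∈))) (near refl) (Near-sym (Near-dist leaf-e₁ leaf-eₗ)) complete
      where
      complete : ∀ {z} → z ∈ X → Near (diam E) z e₁ → z ∈ E
      complete z∈ z~ with ∈-++⁻ K₀ z∈
      ... | inj₁ z∈K₀ = ⊥-elim (K₀-far z∈K₀ z~)
      ... | inj₂ z∈E++K₁ with ∈-++⁻ E z∈E++K₁
      ...   | inj₁ z∈E  = z∈E
      ...   | inj₂ z∈K₁ = ⊥-elim (K₁-far z∈K₁ z~)

    closed-equidistantʳ : (K₁≢[] : K₁ ≢ []) → (∀ {e} → e ∈ E → dist e (hd K₁) ≡ dist e₁ (hd K₁)) →
      (∀ {e} → e ∈ E → ∀ {z} → z ∈ K₀ → dist e (hd K₁) < dist z e) → Closed N X E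
    closed-equidistantʳ K₁≢[] equidistant closer = closed-if-far K₀-far K₁-far
      where
      b∈ = hd∈ K₁≢[]
      E<K₁ : ∀ {e w} → e ∈ E → w ∈ K₁ → e < w
      E<K₁ = StrictlySorted-++⇒< {E} (StrictlySorted-++⁻ʳ {K₀} sorted)
      diam< : diam E < dist e₁ (hd K₁)
      diam< = dist-sameSideˡ leaf-e₁ leaf-eₗ (leaves (∈-++⁺ʳ K₀ (∈-++⁺ʳ E b∈))) (E<K₁ e₁∈ b∈) (E<K₁ eₗ∈ b∈) (sym (equidistant eₗ∈))
      K₀-far : ∀ {z} → z ∈ K₀ → Near (diam E) z e₁ → ⊥
      K₀-far z∈ z~ = <-irrefl refl (<-trans (closer e₁∈ z∈) (≤-<-trans (Near⇒dist≤ z~) diam<))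
      K₁-far : ∀ {z} → z ∈ K₁ → Near (diam E) z e₁ → ⊥
      K₁-far z∈ z~ = <-irrefl refl (≤-<-trans (Near⇒dist≤ (Near-betweenˡ (<⇒≤ (E<K₁ e₁∈ b∈))
        (hd-≤ (StrictlySorted-++⁻ʳ {E} (StrictlySorted-++⁻ʳ {K₀} sorted)) z∈) (Near-sym z~))) diam<)

    closed-equidistantˡ : (K₀≢[] : K₀ ≢ []) → (∀ {e} → e ∈ E → dist (lst K₀) e ≡ dist (lst K₀) e₁) →
      (∀ {e} → e ∈ E → ∀ {w} → w ∈ K₁ → dist (lst K₀) e < dist e w) → Closed N X E
    closed-equidistantˡ K₀≢[] equidistant closer = closed-if-far K₀-far K₁-far
      where
      a∈ = lst∈ K₀≢[]
      K₀<E : ∀ {z e} → z ∈ K₀ → e ∈ E → z < e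
      K₀<E z∈ e∈ = StrictlySorted-++⇒< {K₀} sorted z∈ (∈-++⁺ˡ e∈)
      diam< : diam E < dist (lst K₀) e₁
      diam< = dist-sameSideʳ leaf-e₁ leaf-eₗ (leaves (∈-++⁺ˡ a∈)) (K₀<E a∈ e₁∈) (K₀<E a∈ eₗ∈) (sym (equidistant eₗ∈))
      K₀-far : ∀ {z} → z ∈ K₀ → Near (diam E) z e₁ → ⊥
      K₀-far z∈ z~ = <-irrefl refl (≤-<-trans (Near⇒dist≤ (Near-betweenʳ (≤-lst (StrictlySorted-++⁻ˡ {K₀} sorted) z∈)
        (<⇒≤ (K₀<E a∈ e₁∈)) z~)) diam<)
      K₁-far : ∀ {z} → z ∈ K₁ → Near (diam E) z e₁ → ⊥
      K₁-far z∈ z~ = <-irrefl refl (<-trans (closer e₁∈ z∈) (≤-<-trans (Near⇒dist≤ (Near-sym z~)) diam<))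

  -- The handle is A = {w ∈ K₁ : dist b w < dist (hd T) b}; no-cut makes it a ball around
  -- b = min K₁ small enough to exclude every tooth.
  module CombWithHandleInK₁ (K₀ T K₁ : List ℕ)
    (sorted : StrictlySorted (K₀ ++ T ++ K₁)) (leaves : AllLeaves (K₀ ++ T ++ K₁))
    (T≢[] : T ≢ []) (K₁≢[] : K₁ ≢ [])
    (descent : AllPairs (λ s t → dist t (hd K₁) < dist s (hd K₁)) T)
    (closer : ∀ {t} → t ∈ T → ∀ {z} → z ∈ K₀ → dist t (hd K₁) < dist z t)
    (no-cut : ∀ {w} → w ∈ K₁ → dist (hd K₁) w < dist (hd T) (hd K₁) → dist (hd K₁) w < dist (lst T) (hd K₁))
    where

    private
      X = K₀ ++ T ++ K₁
      b = hd K₁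
      β₁ = dist (hd T) b
      βₛ = dist (lst T) b
      ∈K₀ : ∀ {z} → z ∈ K₀ → z ∈ X
      ∈K₀ = ∈-++⁺ˡ
      ∈T : ∀ {z} → z ∈ T → z ∈ X
      ∈T z∈ = ∈-++⁺ʳ K₀ (∈-++⁺ˡ z∈)
      ∈K₁ : ∀ {z} → z ∈ K₁ → z ∈ X
      ∈K₁ z∈ = ∈-++⁺ʳ K₀ (∈-++⁺ʳ T z∈)
      sorted-K₁ = StrictlySorted-++⁻ʳ {T} (StrictlySorted-++⁻ʳ {K₀} sorted)
      b∈ = hd∈ K₁≢[]
      t₁∈ = hd∈ T≢[]
      tₛ∈ = lst∈ T≢[]
      leaf-b = leaves (∈K₁ b∈)
      leaf-t₁ = leaves (∈T t₁∈)

    T<K₁ : ∀ {t w} → t ∈ T → w ∈ K₁ → t < w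
    T<K₁ = StrictlySorted-++⇒< {T} (StrictlySorted-++⁻ʳ {K₀} sorted)

    β₁-pos : 0 < β₁
    β₁-pos with dist-pos leaf-t₁ leaf-b (T<K₁ t₁∈ b∈)
    ... | _ , β₁≡ = subst (0 <_) (sym β₁≡) z<s

    βₛ≤-≤β₁ : ∀ {t} → t ∈ T → βₛ ≤ dist t b × dist t b ≤ β₁
    βₛ≤-≤β₁ t∈ = AllPairs-last ≤-refl (AllPairs.map <⇒≤ descent) t∈ , AllPairs-head ≤-refl (AllPairs.map <⇒≤ descent) t∈

    K₀-far : ∀ {z} → z ∈ K₀ → dist z b ≤ β₁ → ⊥
    K₀-far z∈ zb≤β₁ = <-irrefl refl (<-≤-trans (closer t₁∈ z∈)
      (≤-trans (dist-ultra (leaves (∈K₀ z∈)) leaf-b leaf-t₁) (⊔-lub zb≤β₁ (≤-reflexive (dist-sym leaf-b leaf-t₁)))))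

    teeth-IncChain : ∀ T′ → (∀ {t} → t ∈ T′ → IsLeaf t) → AllPairs (λ s t → dist t b < dist s b) T′ → IncChain N (T′ ++ [ b ])
    teeth-IncChain []            _      _ = tt
    teeth-IncChain (t ∷ [])      _      _ = inj₂ refl , tt
    teeth-IncChain (t ∷ t′ ∷ T′) leaf ((t′b<tb ∷ _) ∷ desc) =
      inj₁ (dist<⇒δ> {t} {t′} {t′} {hd (T′ ++ [ b ])} (subst₂ _<_ (sym (next T′ (λ z∈ → leaf (there z∈)) desc)) (sym tt′≡tb) t′b<tb)) ,
      teeth-IncChain (t′ ∷ T′) (λ z∈ → leaf (there z∈)) desc
      where
      tt′≡tb = dist-isosceles (leaf (here refl)) (leaf (there (here refl))) leaf-b t′b<tb
      next : ∀ T″ → (∀ {z} → z ∈ t′ ∷ T″ → IsLeaf z) → AllPairs (λ s t → dist t b < dist s b) (t′ ∷ T″) →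
        dist t′ (hd (T″ ++ [ b ])) ≡ dist t′ b
      next []       _    _                  = refl
      next (_ ∷ _) leaf′ ((t″b<t′b ∷ _) ∷ _) = dist-isosceles (leaf′ (here refl)) (leaf′ (there (here refl))) leaf-b t″b<t′b

    module Handle (A R : List ℕ) (K₁≡ : K₁ ≡ A ++ R) (A-near : All (λ w → dist b w < β₁) A)
                  (stop : R ≡ [] ⊎ ¬ (dist b (hd R) < β₁)) where

      A≢[] : A ≢ []
      A≢[] A≡[] = [ (λ R≡[] → K₁≢[] (trans K₁≡R R≡[])) ,
                    (λ ¬near → ¬near (subst (λ u → dist b u < β₁) (cong hd K₁≡R) (subst (_< β₁) (sym (dist-refl b)) β₁-pos))) ]′ stop
        where
        K₁≡R = trans K₁≡ (cong (_++ R) A≡[])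

      private
        ∈A : ∀ {w} → w ∈ A → w ∈ K₁
        ∈A w∈ = subst (_ ∈_) (sym K₁≡) (∈-++⁺ˡ w∈)
        ∈R : ∀ {w} → w ∈ R → w ∈ K₁
        ∈R w∈ = subst (_ ∈_) (sym K₁≡) (∈-++⁺ʳ A w∈)
        aₗ∈ = lst∈ A≢[]
        leaf-aₗ = leaves (∈K₁ (∈A aₗ∈))

      hd-A : hd A ≡ b
      hd-A = sym (trans (cong hd K₁≡) (hd-++ A R A≢[]))

      R-far : ∀ {z} → z ∈ R → β₁ ≤ dist b z
      R-far = far R K₁≡ stop
        where
        far : ∀ R′ → K₁ ≡ A ++ R′ → R′ ≡ [] ⊎ ¬ (dist b (hd R′) < β₁) → ∀ {z} → z ∈ R′ → β₁ ≤ dist b z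
        far (r ∷ R′) K₁≡′ (inj₂ ¬near) {z} z∈ = ≤-trans (≮⇒≥ ¬near)
          (dist-betweenˡ leaf-b (leaves (∈K₁ (∈R′ z∈))) (hd-≤ sorted-K₁ (∈R′ (here refl))) (hd-≤ sorted-R z∈))
          where
          ∈R′ : ∀ {w} → w ∈ r ∷ R′ → w ∈ K₁
          ∈R′ w∈ = subst (_ ∈_) (sym K₁≡′) (∈-++⁺ʳ A w∈)
          sorted-R : StrictlySorted (r ∷ R′)
          sorted-R = StrictlySorted-++⁻ʳ {A} (subst StrictlySorted K₁≡′ sorted-K₁)

      X≡ : X ≡ K₀ ++ (T ++ A) ++ R
      X≡ = cong (K₀ ++_) (trans (cong (T ++_) K₁≡) (sym (++-assoc T A R)))

      classify : ∀ {z} → z ∈ X → z ∈ K₀ ⊎ z ∈ T ⊎ z ∈ A ⊎ z ∈ R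
      classify z∈ with ∈-++⁻ K₀ z∈
      ... | inj₁ z∈K₀ = inj₁ z∈K₀
      ... | inj₂ z∈′ with ∈-++⁻ T z∈′
      ...   | inj₁ z∈T  = inj₂ (inj₁ z∈T)
      ...   | inj₂ z∈K₁ with ∈-++⁻ A (subst (_ ∈_) K₁≡ z∈K₁)
      ...     | inj₁ z∈A = inj₂ (inj₂ (inj₁ z∈A))
      ...     | inj₂ z∈R = inj₂ (inj₂ (inj₂ z∈R))

      closed-T++A : Closed N X (T ++ A)
      closed-T++A = closed-intro X K₀ R (T ++ A) β₁ b (++-≢[] T A T≢[]) X≡
        (StrictlySorted-++⁻ˡ {T ++ A} {R} (subst StrictlySorted (trans (cong (T ++_) K₁≡) (sym (++-assoc T A R)))
          (StrictlySorted-++⁻ʳ {K₀} sorted)))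
        leaf
        (subst (λ u → Near β₁ u b) (sym (hd-++ T A T≢[])) (Near-dist leaf-t₁ leaf-b))
        (subst (λ u → Near β₁ u b) (sym (lst-++ T A A≢[])) (Near-sym (dist≤⇒Near leaf-b leaf-aₗ (<⇒≤ (All.lookup A-near aₗ∈)))))
        complete
        where
        leaf : AllLeaves (T ++ A)
        leaf z∈ with ∈-++⁻ T z∈
        ... | inj₁ z∈T = leaves (∈T z∈T)
        ... | inj₂ z∈A = leaves (∈K₁ (∈A z∈A))
        complete : ∀ {z} → z ∈ X → Near β₁ z b → z ∈ T ++ A
        complete {z} z∈ z~b with classify z∈
        ... | inj₁ z∈K₀                = ⊥-elim (K₀-far z∈K₀ (Near⇒dist≤ z~b))
        ... | inj₂ (inj₁ z∈T)          = ∈-++⁺ˡ z∈T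
        ... | inj₂ (inj₂ (inj₁ z∈A))   = ∈-++⁺ʳ T z∈A
        ... | inj₂ (inj₂ (inj₂ z∈R))   =
          ⊥-elim (dist-consecutive-≢ leaf-t₁ leaf-b leaf-z (T<K₁ t₁∈ b∈) b<z (sym bz≡β₁))
          where
          leaf-z = leaves (∈K₁ (∈R z∈R))
          bz≡β₁ : dist b z ≡ β₁
          bz≡β₁ = ≤-antisym (Near⇒dist≤ (Near-sym z~b)) (R-far z∈R)
          b<z : b < z
          b<z = ≤∧≢⇒< (hd-≤ sorted-K₁ (∈R z∈R))
            λ { refl → <-irrefl (trans (sym (dist-refl b)) bz≡β₁) β₁-pos }

      closed-A : Closed N X A
      closed-A = closed-intro X (K₀ ++ T) R A d b A≢[]
        (trans X≡ (trans (cong (K₀ ++_) (++-assoc T A R)) (sym (++-assoc K₀ T (A ++ R)))))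
        (StrictlySorted-++⁻ˡ {A} (StrictlySorted-++⁻ʳ {T} (subst (λ u → StrictlySorted (T ++ u)) K₁≡ (StrictlySorted-++⁻ʳ {K₀} sorted))))
        (λ z∈ → leaves (∈K₁ (∈A z∈)))
        (subst (λ u → Near d u b) (sym hd-A) (near refl))
        (Near-sym (Near-dist leaf-b leaf-aₗ))
        complete
        where
        d = dist b (lst A)
        d<βₛ : d < βₛ
        d<βₛ = no-cut (∈A aₗ∈) (All.lookup A-near aₗ∈)
        complete : ∀ {z} → z ∈ X → Near d z b → z ∈ A
        complete {z} z∈ z~b with classify z∈
        ... | inj₁ z∈K₀              = ⊥-elim (K₀-far z∈K₀ (≤-trans (Near⇒dist≤ z~b) (≤-trans (<⇒≤ d<βₛ) (proj₂ (βₛ≤-≤β₁ tₛ∈)))))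
        ... | inj₂ (inj₁ z∈T)        = ⊥-elim (<-irrefl refl (≤-<-trans (proj₁ (βₛ≤-≤β₁ z∈T)) (≤-<-trans (Near⇒dist≤ z~b) d<βₛ)))
        ... | inj₂ (inj₂ (inj₁ z∈A)) = z∈A
        ... | inj₂ (inj₂ (inj₂ z∈R)) = ⊥-elim (<-irrefl refl (≤-<-trans (R-far z∈R)
                (≤-<-trans (≤-reflexive (dist-sym leaf-b (leaves (∈K₁ (∈R z∈R)))))
                  (≤-<-trans (Near⇒dist≤ z~b) (<-≤-trans d<βₛ (proj₂ (βₛ≤-≤β₁ tₛ∈)))))))

      split : RightSplit N X (T ++ A) (length A) A T
      split = refl , refl , T≢[] , closed-A ,
        subst (λ u → IncChain N (T ++ [ u ])) (sym hd-A) (teeth-IncChain T (λ z∈ → leaves (∈T z∈)) descent)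

    teeth-of-maxComb : TeethOfMaxComb X T
    teeth-of-maxComb =
      RightSplit⇒maxComb sorted leaves (reverse K₀) (T ++ A) R
        (trans H.X≡ (cong (_++ (T ++ A) ++ R) (sym (reverse-involutive K₀))))
        H.closed-T++A H.split
      where
      near? = λ w → dist b w <? β₁
      A = takeWhile near? K₁
      R = dropWhile near? K₁
      module H = Handle A R (sym (takeWhile++dropWhile near? K₁)) (all-takeWhile near? K₁) (dropWhile-stops near? K₁)

  -- Mirror image of CombWithHandleInK₁: the teeth T recede from a = max K₀.
  module CombWithHandleInK₀ (K₀ T K₁ : List ℕ)
    (sorted : StrictlySorted (K₀ ++ T ++ K₁)) (leaves : AllLeaves (K₀ ++ T ++ K₁))
    (T≢[] : T ≢ []) (K₀≢[] : K₀ ≢ [])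
    (ascent : AllPairs (λ s t → dist (lst K₀) s < dist (lst K₀) t) T)
    (closer : ∀ {t} → t ∈ T → ∀ {w} → w ∈ K₁ → dist (lst K₀) t < dist t w)
    (no-cut : ∀ {w} → w ∈ K₀ → dist w (lst K₀) < dist (lst K₀) (lst T) → dist w (lst K₀) < dist (lst K₀) (hd T))
    where

    private
      X = K₀ ++ T ++ K₁
      a = lst K₀
      α₁ = dist a (hd T)
      αₛ = dist a (lst T)
      ∈K₀ : ∀ {z} → z ∈ K₀ → z ∈ X
      ∈K₀ = ∈-++⁺ˡ
      ∈T : ∀ {z} → z ∈ T → z ∈ X
      ∈T z∈ = ∈-++⁺ʳ K₀ (∈-++⁺ˡ z∈)
      ∈K₁ : ∀ {z} → z ∈ K₁ → z ∈ X
      ∈K₁ z∈ = ∈-++⁺ʳ K₀ (∈-++⁺ʳ T z∈)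
      sorted-K₀ = StrictlySorted-++⁻ˡ {K₀} sorted
      a∈ = lst∈ K₀≢[]
      tₛ∈ = lst∈ T≢[]
      leaf-a = leaves (∈K₀ a∈)
      leaf-tₛ = leaves (∈T tₛ∈)

    K₀<T : ∀ {z t} → z ∈ K₀ → t ∈ T → z < t
    K₀<T z∈ t∈ = StrictlySorted-++⇒< {K₀} sorted z∈ (∈-++⁺ˡ t∈)

    αₛ-pos : 0 < αₛ
    αₛ-pos with dist-pos leaf-a leaf-tₛ (K₀<T a∈ tₛ∈)
    ... | _ , αₛ≡ = subst (0 <_) (sym αₛ≡) z<s

    α₁≤-≤αₛ : ∀ {t} → t ∈ T → α₁ ≤ dist a t × dist a t ≤ αₛ
    α₁≤-≤αₛ t∈ = AllPairs-head ≤-refl (AllPairs.map <⇒≤ ascent) t∈ , AllPairs-last ≤-refl (AllPairs.map <⇒≤ ascent) t∈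

    K₁-far : ∀ {z} → z ∈ K₁ → dist z a ≤ αₛ → ⊥
    K₁-far z∈ za≤αₛ = <-irrefl refl (<-≤-trans (closer tₛ∈ z∈)
      (≤-trans (dist-ultra leaf-tₛ leaf-a leaf-z)
        (⊔-lub (≤-reflexive (dist-sym leaf-tₛ leaf-a)) (≤-trans (≤-reflexive (dist-sym leaf-a leaf-z)) za≤αₛ))))
      where
      leaf-z = leaves (∈K₁ z∈)

    dist-isoscelesˡ : ∀ {t t′} → IsLeaf t → IsLeaf t′ → dist a t < dist a t′ → dist t t′ ≡ dist a t′
    dist-isoscelesˡ leaf-t leaf-t′ at<at′ =
      trans (dist-sym leaf-t leaf-t′)
        (trans (dist-isosceles leaf-t′ leaf-t leaf-a (subst₂ _<_ (dist-sym leaf-a leaf-t) (dist-sym leaf-a leaf-t′) at<at′))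
               (dist-sym leaf-t′ leaf-a))

    teeth-DecChain : ∀ u T′ → (∀ {t} → t ∈ T′ → IsLeaf t) → AllPairs (λ s t → dist a s < dist a t) T′ →
      dist u (hd T′) ≡ dist a (hd T′) → DecChain N (u ∷ T′)
    teeth-DecChain u []            _    _ _     = tt
    teeth-DecChain u (t ∷ [])      _    _ _     = inj₂ refl , tt
    teeth-DecChain u (t ∷ t′ ∷ T′) leaf ((at<at′ ∷ _) ∷ asc) ut≡at =
      inj₁ (dist<⇒δ> {t} {t′} {u} {t} (subst₂ _<_ (sym ut≡at) (sym tt′≡at′) at<at′)) ,
      teeth-DecChain t (t′ ∷ T′) (λ z∈ → leaf (there z∈)) asc tt′≡at′
      where
      tt′≡at′ = dist-isoscelesˡ (leaf (here refl)) (leaf (there (here refl))) at<at′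

    module Handle (R A : List ℕ) (K₀≡ : K₀ ≡ R ++ A) (R-far : All (λ w → ¬ (dist w a < αₛ)) R)
                  (stop : A ≡ [] ⊎ ¬ ¬ (dist (hd A) a < αₛ)) where

      A≢[] : A ≢ []
      A≢[] refl = All.lookup R-far (subst (a ∈_) (trans K₀≡ (++-identityʳ R)) a∈) (subst (_< αₛ) (sym (dist-refl a)) αₛ-pos)

      private
        ∈A : ∀ {w} → w ∈ A → w ∈ K₀
        ∈A w∈ = subst (_ ∈_) (sym K₀≡) (∈-++⁺ʳ R w∈)
        ∈R : ∀ {w} → w ∈ R → w ∈ K₀
        ∈R w∈ = subst (_ ∈_) (sym K₀≡) (∈-++⁺ˡ w∈)
        a₁∈ = hd∈ A≢[]
        leaf-a₁ = leaves (∈K₀ (∈A a₁∈))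

      lst-A : lst A ≡ a
      lst-A = sym (trans (cong lst K₀≡) (lst-++ R A A≢[]))

      A-near : ∀ {w} → w ∈ A → dist w a < αₛ
      A-near = all-near A K₀≡ stop
        where
        all-near : ∀ A′ → K₀ ≡ R ++ A′ → A′ ≡ [] ⊎ ¬ ¬ (dist (hd A′) a < αₛ) → ∀ {w} → w ∈ A′ → dist w a < αₛ
        all-near (x ∷ A′) K₀≡′ (inj₂ ¬¬near) {w} w∈ =
          ≤-<-trans (dist-betweenʳ (leaves (∈K₀ (∈A′ (here refl)))) leaf-a (hd-≤ sorted-A w∈) (≤-lst sorted-K₀ (∈A′ w∈))) x-near
          where
          ∈A′ : ∀ {w} → w ∈ x ∷ A′ → w ∈ K₀
          ∈A′ w∈ = subst (_ ∈_) (sym K₀≡′) (∈-++⁺ʳ R w∈)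
          sorted-A : StrictlySorted (x ∷ A′)
          sorted-A = StrictlySorted-++⁻ʳ {R} (subst StrictlySorted K₀≡′ sorted-K₀)
          x-near : dist x a < αₛ
          x-near with dist x a <? αₛ
          ... | yes x-near = x-near
          ... | no ¬near   = ⊥-elim (¬¬near ¬near)

      X≡ : X ≡ R ++ (A ++ T) ++ K₁
      X≡ = trans (cong (_++ T ++ K₁) K₀≡) (trans (++-assoc R A (T ++ K₁)) (cong (R ++_) (sym (++-assoc A T K₁))))

      classify : ∀ {z} → z ∈ X → z ∈ R ⊎ z ∈ A ⊎ z ∈ T ⊎ z ∈ K₁
      classify z∈ with ∈-++⁻ K₀ z∈
      ... | inj₂ z∈′ with ∈-++⁻ T z∈′
      ...   | inj₁ z∈T  = inj₂ (inj₂ (inj₁ z∈T))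
      ...   | inj₂ z∈K₁ = inj₂ (inj₂ (inj₂ z∈K₁))
      classify z∈ | inj₁ z∈K₀ with ∈-++⁻ R (subst (_ ∈_) K₀≡ z∈K₀)
      ...   | inj₁ z∈R = inj₁ z∈R
      ...   | inj₂ z∈A = inj₂ (inj₁ z∈A)

      closed-A++T : Closed N X (A ++ T)
      closed-A++T = closed-intro X R K₁ (A ++ T) αₛ a (++-≢[] A T A≢[]) X≡
        (StrictlySorted-++⁻ˡ {A ++ T} {K₁} (subst StrictlySorted (sym (++-assoc A T K₁))
          (StrictlySorted-++⁻ʳ {R} (subst StrictlySorted (trans (cong (_++ T ++ K₁) K₀≡) (++-assoc R A (T ++ K₁))) sorted))))
        leaf
        (subst (λ u → Near αₛ u a) (sym (hd-++ A T A≢[])) (dist≤⇒Near leaf-a₁ leaf-a (<⇒≤ (A-near a₁∈))))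
        (subst (λ u → Near αₛ u a) (sym (lst-++ A T T≢[])) (Near-sym (Near-dist leaf-a leaf-tₛ)))
        complete
        where
        leaf : AllLeaves (A ++ T)
        leaf z∈ with ∈-++⁻ A z∈
        ... | inj₁ z∈A = leaves (∈K₀ (∈A z∈A))
        ... | inj₂ z∈T = leaves (∈T z∈T)
        complete : ∀ {z} → z ∈ X → Near αₛ z a → z ∈ A ++ T
        complete {z} z∈ z~a with classify z∈
        ... | inj₂ (inj₁ z∈A)          = ∈-++⁺ˡ z∈A
        ... | inj₂ (inj₂ (inj₁ z∈T))   = ∈-++⁺ʳ A z∈T
        ... | inj₂ (inj₂ (inj₂ z∈K₁))  = ⊥-elim (K₁-far z∈K₁ (Near⇒dist≤ z~a))
        ... | inj₁ z∈R =
          ⊥-elim (dist-consecutive-≢ leaf-z leaf-a leaf-tₛ z<a (K₀<T a∈ tₛ∈) za≡αₛ)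
          where
          leaf-z = leaves (∈K₀ (∈R z∈R))
          za≡αₛ : dist z a ≡ αₛ
          za≡αₛ = ≤-antisym (Near⇒dist≤ z~a) (≮⇒≥ (All.lookup R-far z∈R))
          z<a : z < a
          z<a = ≤∧≢⇒< (≤-lst sorted-K₀ (∈R z∈R))
            λ { refl → <-irrefl (trans (sym (dist-refl z)) za≡αₛ) αₛ-pos }

      closed-A : Closed N X A
      closed-A = closed-intro X R (T ++ K₁) A d a A≢[]
        (trans (cong (_++ T ++ K₁) K₀≡) (++-assoc R A (T ++ K₁)))
        (StrictlySorted-++⁻ʳ {R} (subst StrictlySorted K₀≡ sorted-K₀))
        (λ z∈ → leaves (∈K₀ (∈A z∈)))
        (Near-dist leaf-a₁ leaf-a)
        (subst (λ u → Near d u a) (sym lst-A) (near refl))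
        complete
        where
        d = dist (hd A) a
        d<α₁ : d < α₁
        d<α₁ = no-cut (∈A a₁∈) (A-near a₁∈)
        complete : ∀ {z} → z ∈ X → Near d z a → z ∈ A
        complete {z} z∈ z~a with classify z∈
        ... | inj₂ (inj₁ z∈A)         = z∈A
        ... | inj₁ z∈R                = ⊥-elim (All.lookup R-far z∈R (≤-<-trans (Near⇒dist≤ z~a) (A-near a₁∈)))
        ... | inj₂ (inj₂ (inj₁ z∈T))  = ⊥-elim (<-irrefl refl (≤-<-trans (proj₁ (α₁≤-≤αₛ z∈T))
                (≤-<-trans (≤-reflexive (dist-sym leaf-a (leaves (∈T z∈T)))) (≤-<-trans (Near⇒dist≤ z~a) d<α₁))))
        ... | inj₂ (inj₂ (inj₂ z∈K₁)) = ⊥-elim (K₁-far z∈K₁ (≤-trans (Near⇒dist≤ z~a) (<⇒≤ (A-near a₁∈))))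

      split : LeftSplit N X (A ++ T) (length A) A T
      split = refl , refl , T≢[] , closed-A ,
        subst (λ u → DecChain N (u ∷ T)) (sym lst-A) (teeth-DecChain a T (λ z∈ → leaves (∈T z∈)) ascent refl)

    teeth-of-maxComb : TeethOfMaxComb X T
    teeth-of-maxComb = LeftSplit⇒maxComb sorted leaves R (A ++ T) K₁ H.X≡ H.closed-A++T H.split
      where
      far? = λ w → ¬? (dist w a <? αₛ)
      R = takeWhile far? K₀
      A = dropWhile far? K₀
      module H = Handle R A (sym (takeWhile++dropWhile far? K₀)) (all-takeWhile far? K₀) (dropWhile-stops far? K₀)

  -- The two sides of the kernel

  module SimpleDaisy (K₀ M K₁ : List ℕ) (sorted-K₀ : StrictlySorted K₀) (sorted-M : StrictlySorted M)
    (sorted-K₁ : StrictlySorted K₁) (leaves : Leaves N (K₀ ++ M ++ K₁)) (K₀≺M : K₀ ≺ M) (M≺K₁ : M ≺ K₁) (M≢[] : M ≢ []) where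

    private
      a = lst K₀
      b = hd K₁
      ∈M : ∀ {x} → x ∈ M → x ∈ K₀ ++ M ++ K₁
      ∈M x∈ = ∈-++⁺ʳ K₀ (∈-++⁺ˡ x∈)
      leaf : ∀ {x} → x ∈ K₀ ++ M ++ K₁ → IsLeaf x
      leaf = All.lookup leaves

    Shape : List ℕ → Set
    Shape M′ = Closed N (K₀ ++ M′ ++ K₁) M′ ⊎ TeethOfMaxComb (K₀ ++ M′ ++ K₁) M′

    Candidate : List ℕ → Set
    Candidate M′ = M′ ≡ [] ⊎ (StrictlySorted M′ × M′ ⊆ M × Shape M′)

    SplitCandidates : ℕ → List ℕ → Set
    SplitCandidates c L = ∃[ E ] ∃[ T ] Candidate E × Candidate T × length L ≤ suc c * (length T * length E)

    sorted-restrict : ∀ {M′} → M′ ⊑ M → StrictlySorted (K₀ ++ M′ ++ K₁)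
    sorted-restrict {M′} M′⊑M =
      StrictlySorted-++ sorted-K₀ (StrictlySorted-++ (StrictlySorted-resp-⊑ M′⊑M sorted-M) sorted-K₁ (All-resp-⊆ M′⊑M M≺K₁))
        (All.map (λ z≺M → All.tabulate λ w∈ → [ (λ w∈M′ → All.lookup z≺M (Any-resp-⊆ M′⊑M w∈M′)) , (λ w∈K₁ → z<K₁ z≺M w∈K₁) ]′ (∈-++⁻ M′ w∈)) K₀≺M)
      where
      z<K₁ : ∀ {z w} → All (z <_) M → w ∈ K₁ → z < w
      z<K₁ z≺M w∈ = <-trans (All.lookup z≺M (hd∈ M≢[])) (All.lookup (All.lookup M≺K₁ (hd∈ M≢[])) w∈)

    leaves-restrict : ∀ {M′} → M′ ⊑ M → AllLeaves (K₀ ++ M′ ++ K₁)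
    leaves-restrict {M′} M′⊑M z∈ with ∈-++⁻ K₀ z∈
    ... | inj₁ z∈K₀ = leaf (∈-++⁺ˡ z∈K₀)
    ... | inj₂ z∈′ with ∈-++⁻ M′ z∈′
    ...   | inj₁ z∈M′ = leaf (∈M (Any-resp-⊆ M′⊑M z∈M′))
    ...   | inj₂ z∈K₁ = leaf (∈-++⁺ʳ K₀ (∈-++⁺ʳ M z∈K₁))

    candidate : ∀ M′ → M′ ⊑ M → (M′ ≢ [] → Shape M′) → Candidate M′
    candidate []         _    _     = inj₁ refl
    candidate M′@(_ ∷ _) M′⊑M shape = inj₂ (StrictlySorted-resp-⊑ M′⊑M sorted-M , Any-resp-⊆ M′⊑M , shape (λ ()))

    no-candidates : ∀ c → SplitCandidates c []
    no-candidates c = [] , [] , inj₁ refl , inj₁ refl , z≤n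

    NearerK₁ : ℕ → Set
    NearerK₁ x = ∀ {z} → z ∈ K₀ → dist x b < dist z x

    NearerK₀ : ℕ → Set
    NearerK₀ x = ∀ {w} → w ∈ K₁ → dist a x < dist x w

    -- part x indexes the interval between consecutive cuts dist b w (w ∈ K₁) containing dist x b.
    side-K₁ : K₁ ≢ [] → ∀ L → L ⊑ M → All NearerK₁ L → SplitCandidates (length K₁) L
    side-K₁ K₁≢[] L L⊑M nearer
      with refine part (λ x → dist x b) (length cuts) L
             (AllPairs.map (countBelow-mono cuts) dist-descends) (All.tabulate λ _ → countBelow≤length cuts _) dist-descends
      where
      cuts = map (dist b) K₁
      part = λ x → countBelow (dist x b) cuts
      leaf-b = leaf (∈-++⁺ʳ K₀ (∈-++⁺ʳ M (hd∈ K₁≢[])))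
      dist-descends : AllPairs (λ s t → dist t b ≤ dist s b) L
      dist-descends = StrictlySorted⇒AllPairs L (StrictlySorted-resp-⊑ L⊑M sorted-M) λ s∈ t∈ s<t →
        dist-betweenʳ (leaf (∈M (Any-resp-⊆ L⊑M s∈))) leaf-b (<⇒≤ s<t) (<⇒≤ (All.lookup (All.lookup M≺K₁ (Any-resp-⊆ L⊑M t∈)) (hd∈ K₁≢[])))
    ... | refinement E T E⊑L T⊑L u v E≡v T≡u T-desc len =
      E , T , candidate E (⊆-trans E⊑L L⊑M) plateau , candidate T (⊆-trans T⊑L L⊑M) descent ,
      subst (λ c → length L ≤ suc c * (length T * length E)) (length-map (dist b) K₁) len
      where
      cuts = map (dist b) K₁
      plateau : E ≢ [] → Shape E
      plateau E≢[] = inj₁ (Equidistant.closed-equidistantʳ K₀ E K₁ (sorted-restrict E⊑M) (leaves-restrict E⊑M) E≢[] K₁≢[]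
        (λ e∈ → trans (All.lookup E≡v e∈) (sym (All.lookup E≡v (hd∈ E≢[])))) (λ e∈ → All.lookup (All-resp-⊆ E⊑L nearer) e∈))
        where E⊑M = ⊆-trans E⊑L L⊑M
      descent : T ≢ [] → Shape T
      descent T≢[] = inj₂ (CombWithHandleInK₁.teeth-of-maxComb K₀ T K₁ (sorted-restrict T⊑M) (leaves-restrict T⊑M) T≢[] K₁≢[]
        T-desc (λ t∈ → All.lookup (All-resp-⊆ T⊑L nearer) t∈) no-cut)
        where
        T⊑M = ⊆-trans T⊑L L⊑M
        no-cut : ∀ {w} → w ∈ K₁ → dist b w < dist (hd T) b → dist b w < dist (lst T) b
        no-cut {w} w∈ bw< with dist b w <? dist (lst T) b
        ... | yes bw<ₛ = bw<ₛ
        ... | no  bw≮ₛ = ⊥-elim (<-irrefl (trans (All.lookup T≡u (lst∈ T≢[])) (sym (All.lookup T≡u (hd∈ T≢[]))))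
                           (countBelow-< cuts (∈-map⁺ (dist b) w∈) (≮⇒≥ bw≮ₛ) bw<))

    -- Mirror image of side-K₁; dist a · grows along M, so it enters reflected as N ∸ dist a ·.
    side-K₀ : K₀ ≢ [] → ∀ L → L ⊑ M → All NearerK₀ L → SplitCandidates (length K₀) L
    side-K₀ K₀≢[] L L⊑M nearer
      with refine part (λ x → N ∸ dist a x) (length cuts) L
             (AllPairs.map (λ as≤at → ∸-monoʳ-≤ (length cuts) (countBelow-mono cuts as≤at)) dist-ascends)
             (All.tabulate λ {x} _ → m∸n≤m (length cuts) (countBelow (dist a x) cuts))
             (AllPairs.map (∸-monoʳ-≤ N) dist-ascends)
      where
      cuts = map (λ w → dist w a) K₀
      part = λ x → length cuts ∸ countBelow (dist a x) cuts
      leaf-a = leaf (∈-++⁺ˡ (lst∈ K₀≢[]))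
      dist-ascends : AllPairs (λ s t → dist a s ≤ dist a t) L
      dist-ascends = StrictlySorted⇒AllPairs L (StrictlySorted-resp-⊑ L⊑M sorted-M) λ s∈ t∈ s<t →
        dist-betweenˡ leaf-a (leaf (∈M (Any-resp-⊆ L⊑M t∈))) (<⇒≤ (All.lookup (All.lookup K₀≺M (lst∈ K₀≢[])) (Any-resp-⊆ L⊑M s∈))) (<⇒≤ s<t)
    ... | refinement E T E⊑L T⊑L u v E≡v T≡u T-desc len =
      E , T , candidate E (⊆-trans E⊑L L⊑M) plateau , candidate T (⊆-trans T⊑L L⊑M) descent ,
      subst (λ c → length L ≤ suc c * (length T * length E)) (length-map (λ w → dist w a) K₀) len
      where
      cuts = map (λ w → dist w a) K₀
      plateau : E ≢ [] → Shape E
      plateau E≢[] = inj₁ (Equidistant.closed-equidistantˡ K₀ E K₁ (sorted-restrict E⊑M) (leaves-restrict E⊑M) E≢[] K₀≢[]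
        (λ {e} e∈ → ∸-cancelˡ-≡ (dist≤N a e) (dist≤N a (hd E)) (trans (All.lookup E≡v e∈) (sym (All.lookup E≡v (hd∈ E≢[])))))
        (λ e∈ → All.lookup (All-resp-⊆ E⊑L nearer) e∈))
        where E⊑M = ⊆-trans E⊑L L⊑M
      descent : T ≢ [] → Shape T
      descent T≢[] = inj₂ (CombWithHandleInK₀.teeth-of-maxComb K₀ T K₁ (sorted-restrict T⊑M) (leaves-restrict T⊑M) T≢[] K₀≢[]
        (AllPairs.map ∸-cancelʳ-< T-desc) (λ t∈ → All.lookup (All-resp-⊆ T⊑L nearer) t∈) no-cut)
        where
        T⊑M = ⊆-trans T⊑L L⊑M
        no-cut : ∀ {w} → w ∈ K₀ → dist w a < dist a (lst T) → dist w a < dist a (hd T)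
        no-cut {w} w∈ wa< with dist w a <? dist a (hd T)
        ... | yes wa<₁ = wa<₁
        ... | no  wa≮₁ = ⊥-elim (<-irrefl
                           (∸-cancelˡ-≡ (countBelow≤length cuts _) (countBelow≤length cuts _)
                             (trans (All.lookup T≡u (hd∈ T≢[])) (sym (All.lookup T≡u (lst∈ T≢[])))))
                           (countBelow-< cuts (∈-map⁺ (λ w → dist w a) w∈) (≮⇒≥ wa≮₁) wa<))

    LeansRight : ℕ → Set
    LeansRight x = K₁ ≢ [] × (K₀ ≡ [] ⊎ dist x b < dist a x)

    LeansRight? : ∀ x → Dec (LeansRight x)
    LeansRight? x = ≢[]? K₁ ×-dec ([]? K₀ ⊎-dec (dist x b <? dist a x))

    LeansRight⇒NearerK₁ : ∀ {x} → x ∈ M → LeansRight x → NearerK₁ x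
    LeansRight⇒NearerK₁ x∈ (_ , inj₁ refl) ()
    LeansRight⇒NearerK₁ {x} x∈ (_ , inj₂ xb<ax) {z} z∈ =
      <-≤-trans xb<ax (dist-betweenʳ (leaf (∈-++⁺ˡ z∈)) (leaf (∈M x∈)) (≤-lst sorted-K₀ z∈)
        (<⇒≤ (All.lookup (All.lookup K₀≺M (lst∈ (∈⇒≢[] z∈))) x∈)))

    -- Ties dist a x = dist x b are impossible: a < x < b.
    ¬LeansRight⇒NearerK₀ : ∀ {x} → x ∈ M → ¬ LeansRight x → NearerK₀ x
    ¬LeansRight⇒NearerK₀ {x} x∈ ¬right {w} w∈ =
      <-≤-trans ax<xb (dist-betweenˡ leaf-x (leaf (∈-++⁺ʳ K₀ (∈-++⁺ʳ M w∈))) (<⇒≤ x<b) (hd-≤ sorted-K₁ w∈))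
      where
      K₁≢[] = ∈⇒≢[] w∈
      K₀≢[] : K₀ ≢ []
      K₀≢[] K₀≡[] = ¬right (K₁≢[] , inj₁ K₀≡[])
      leaf-x = leaf (∈M x∈)
      x<b = All.lookup (All.lookup M≺K₁ x∈) (hd∈ K₁≢[])
      ax≤xb : dist a x ≤ dist x b
      ax≤xb with dist x b <? dist a x
      ... | yes xb<ax = ⊥-elim (¬right (K₁≢[] , inj₂ xb<ax))
      ... | no  xb≮ax = ≮⇒≥ xb≮ax
      ax<xb = ≤∧≢⇒< ax≤xb (dist-consecutive-≢ (leaf (∈-++⁺ˡ (lst∈ K₀≢[]))) leaf-x (leaf (∈-++⁺ʳ K₀ (∈-++⁺ʳ M (hd∈ K₁≢[]))))
                (All.lookup (All.lookup K₀≺M (lst∈ K₀≢[])) x∈) x<b)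

    right-candidates : SplitCandidates (length K₁) (filter LeansRight? M)
    right-candidates with filter LeansRight? M | filter-⊆ LeansRight? M | all-filter LeansRight? M
    ... | []    | _   | _ = no-candidates (length K₁)
    ... | L@(_ ∷ _) | L⊑M | right@((K₁≢[] , _) ∷ _) =
      side-K₁ K₁≢[] L L⊑M (All.tabulate λ x∈ → LeansRight⇒NearerK₁ (Any-resp-⊆ L⊑M x∈) (All.lookup right x∈))

    left-candidates : 1 ≤ length K₀ + length K₁ → SplitCandidates (length K₀) (filter (∁? LeansRight?) M)
    left-candidates 1≤k with filter (∁? LeansRight?) M | filter-⊆ (∁? LeansRight?) M | all-filter (∁? LeansRight?) M
    ... | []    | _   | _ = no-candidates (length K₀)
    ... | L@(_ ∷ _) | L⊑M | left@(¬right ∷ _) =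
      side-K₀ K₀≢[] L L⊑M (All.tabulate λ x∈ → ¬LeansRight⇒NearerK₀ (Any-resp-⊆ L⊑M x∈) (All.lookup left x∈))
      where
      K₀≢[] : K₀ ≢ []
      K₀≢[] K₀≡[] = ¬right ((λ { refl → <-irrefl (sym (cong (λ K → length K + 0) K₀≡[])) 1≤k }) , inj₁ K₀≡[])

    closed-or-teeth : ∀ k → length K₀ + length K₁ ≡ k → 1 ≤ k →
      ∃[ M′ ] StrictlySorted M′ × M′ ⊆ M × length M ≤ 4 * k * (length M′ ^ 2) × Shape M′
    closed-or-teeth k k≡ 1≤k
      with right-candidates | left-candidates (subst (1 ≤_) (sym k≡) 1≤k)
    ... | E₁ , T₁ , cE₁ , cT₁ , len₁ | E₀ , T₀ , cE₀ , cT₀ , len₀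
      with longest Candidate E₁ T₁ cE₁ cT₁ | longest Candidate E₀ T₀ cE₀ cT₀
    ... | S₁ , cS₁ , E₁≤ , T₁≤ | S₀ , cS₀ , E₀≤ , T₀≤
      with longest Candidate S₁ S₀ cS₁ cS₀
    ... | S , cS , S₁≤ , S₀≤ = conclude cS
      where
      bound : length M ≤ 4 * k * (length S ^ 2)
      bound = ≤-trans (length-filter-∁ LeansRight? M) (≤-trans (+-mono-≤ len₁ len₀)
        (two-sides-bound (length K₀) (length K₁) k≡ 1≤k (≤-trans T₁≤ S₁≤) (≤-trans E₁≤ S₁≤) (≤-trans T₀≤ S₀≤) (≤-trans E₀≤ S₀≤)))
      conclude : Candidate S → ∃[ M′ ] StrictlySorted M′ × M′ ⊆ M × length M ≤ 4 * k * (length M′ ^ 2) × Shape M′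
      conclude (inj₁ refl) = ⊥-elim (M≢[] (length≡0⇒≡[] M (n≤0⇒n≡0 (subst (length M ≤_) (*-zeroʳ (4 * k)) bound))))
      conclude (inj₂ (sorted , S⊆M , shape)) = S , sorted , S⊆M , bound , shape

lemma5p1 : (N r m k : ℕ) → 1 ≤ N → 1 ≤ r → 1 ≤ m → 1 ≤ k →
    (K₀ M K₁ : List ℕ) →
    StrictlySorted K₀ → StrictlySorted M → StrictlySorted K₁ →
    Leaves N (K₀ ++ M ++ K₁) →
    length K₀ + length K₁ ≡ k → length M ≡ m →
    K₀ ≺ M → M ≺ K₁ →
    ∃[ M' ] (StrictlySorted M' × M' ⊆ M × m ≤ 4 * k * (length M' ^ 2) ×
      (Closed N (K₀ ++ M' ++ K₁) M' ⊎
       ∃[ I ] ∃[ A ] ∃[ B ] (MaxComb N (K₀ ++ M' ++ K₁) I A B × M' ⊆ B)))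
-- Only the vertex set of the daisy matters.
lemma5p1 N r m k _ _ 1≤m 1≤k K₀ M K₁ sorted-K₀ sorted-M sorted-K₁ leaves k≡ refl K₀≺M M≺K₁ =
  SimpleDaisy.closed-or-teeth N K₀ M K₁ sorted-K₀ sorted-M sorted-K₁ leaves K₀≺M M≺K₁ M≢[] k k≡ 1≤k
  where
  M≢[] : M ≢ []
  M≢[] M≡[] = <⇒≢ 1≤m (sym (cong length M≡[]))
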